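{- Let $X=\{x_1,\ldots,x_n\}$. There is a deterministic learning algorithm which, for every non-constant Boolean function $f$ of the variables $X$ that is read-once over the basis $\{\land,\lor\}$, identifies $f$ exactly using only subcube identity queries, and it performs $O(n^2)$ such queries in the worst case.
   Context: A formula over a set $\mathcal B$ of Boolean functions (a basis) is read-once if every variable occurring in it occurs exactly once; a Boolean function of the variables $X$ is read-once over $\mathcal B$ if it can be expressed by a read-once formula over $\mathcal B$ (variables of $X$ not occurring in the formula are fictitious for the function). A partial assignment $p$ to $X$ is a map $X\to\{0,1,*\}$; it is total if it takes no variable to $*$. The projection $f_p$ is the function of the variables $p^{ -1}(*)$ obtained from $f$ by fixing each $x_i\notin p^{ -1}(*)$ to $p(x_i)$. A subcube identity query takes a partial assignment $p$ and answers "yes" if $f_p\equiv 0$ or $f_p\equiv 1$, and "no" otherwise (no further information). Exact identification: the set $X$ and the basis are known in advance; an algorithm adaptively asks queries about the unknown target function $f$ (from the given class) and must determine $f$ exactly; its complexity is the worst-case number of queries over all targets in the class. -}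

module Defs where

open import Data.Nat using (ℕ; zero; suc; _*_; _≤_)
open import Data.Bool using (Bool; true; false; _∧_; _∨_)
open import Data.Fin using (Fin)
open import Data.Maybe using (Maybe; just; nothing)
open import Data.List using (List; []; _∷_; _++_)
open import Data.List.Relation.Unary.Unique.Propositional using (Unique)
open import Data.Product using (Σ; ∃; _×_; _,_)
open import Data.Sum using (_⊎_)
open import Relation.Binary.PropositionalEquality using (_≡_; _≢_)

Assignment : ℕ → Set
Assignment n = Fin n → Bool

BoolFun : ℕ → Set
BoolFun n = Assignment n → Bool

data Formula (n : ℕ) : Set where
  var  : Fin n → Formula n
  and′ : Formula n → Formula n → Formula n
  or′  : Formula n → Formula n → Formula n

eval : ∀ {n} → Formula n → Assignment n → Bool
eval (var i)    a = a i
eval (and′ φ ψ) a = eval φ a ∧ eval ψ a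
eval (or′ φ ψ)  a = eval φ a ∨ eval ψ a

occurrences : ∀ {n} → Formula n → List (Fin n)
occurrences (var i)    = i ∷ []
occurrences (and′ φ ψ) = occurrences φ ++ occurrences ψ
occurrences (or′ φ ψ)  = occurrences φ ++ occurrences ψ

ReadOnceFormula : ∀ {n} → Formula n → Set
ReadOnceFormula φ = Unique (occurrences φ)

ReadOnce : ∀ {n} → BoolFun n → Set
ReadOnce {n} f = Σ (Formula n) λ φ → ReadOnceFormula φ × (∀ a → eval φ a ≡ f a)

NonConstant : ∀ {n} → BoolFun n → Set
NonConstant f = ∃ λ a → ∃ λ b → f a ≢ f b

-- Partial assignments: nothing stands for *.
PartialAssignment : ℕ → Set
PartialAssignment n = Fin n → Maybe Bool

_⊕_ : ∀ {n} → PartialAssignment n → Assignment n → Assignment n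
(p ⊕ a) i with p i
... | just b  = b
... | nothing = a i

ProjectionConstant : ∀ {n} → BoolFun n → PartialAssignment n → Set
ProjectionConstant f p = (∀ a → f (p ⊕ a) ≡ false) ⊎ (∀ a → f (p ⊕ a) ≡ true)

-- b is the correct answer (true = "yes") to the subcube identity query p.
CorrectAnswer : ∀ {n} → BoolFun n → PartialAssignment n → Bool → Set
CorrectAnswer f p b = (b ≡ true → ProjectionConstant f p) × (ProjectionConstant f p → b ≡ true)

-- Deterministic adaptive algorithms using subcube identity queries:
-- finite decision trees whose internal nodes are queries and whose leaves
-- output a hypothesis function.
data Algorithm (n : ℕ) : Set where
  output : BoolFun n → Algorithm n
  ask    : PartialAssignment n → (Bool → Algorithm n) → Algorithm n

data Runs {n : ℕ} : Algorithm n → BoolFun n → ℕ → BoolFun n → Set where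
  done : ∀ {f h} → Runs (output h) f zero h
  step : ∀ {f p k b q h} → CorrectAnswer f p b → Runs (k b) f q h →
         Runs (ask p k) f (suc q) h

-- A read-once formula over {∧, ∨} is monotone and maps 0…0 to 0, so the subcube of points below a
-- is constant exactly when f(a) = 0: subcube queries simulate membership queries.
-- The function is determined by its relevant variables together with the relation "the lowest common
-- ancestor of s and t is an ∧": a satisfies f iff some clique of this relation among the 1s of a
-- cannot be extended by any 0 of a (the maximal cliques are the minterms).
-- Relevant variables are found from a minimal true point: for each relevant k, two greedy passes of
-- n queries give a maximal false point c_k and a minimal true point for k, and their 0s resp. 1s
-- always reach new relevant variables until all are found, so n rounds suffice.
-- For relevant i ≠ j, the lowest common ancestor is an ∧ iff c_j(i) = c_i(j) = 1 and f accepts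
-- (c_i ∧ c_j) ∨ e_i ∨ e_j; this costs n² further queries, at most 4n² in all.

module Submission where

open import Defs
open import Data.Nat using (ℕ; zero; suc; _+_; _*_; _≤_; z≤n; s≤s)
open import Data.Nat.Properties
  using (+-identityʳ; +-suc; ≤-trans; ≤-reflexive; <-irrefl; m≤n⇒m≤1+n; m≤m*n; +-monoˡ-≤; +-monoʳ-≤; +-mono-≤; module ≤-Reasoning)
open import Data.Nat.Tactic.RingSolver using (solve-∀)
open import Data.Bool using (Bool; true; false; _∧_; _∨_; not; if_then_else_)
open import Data.Bool.Properties
  using (∨-zeroʳ; ∨-identityʳ; ∧-zeroʳ; ∧-identityʳ; not-involutive)
  renaming (_≟_ to _≟ᵇ_)
open import Data.Unit using (⊤; tt)
open import Data.Fin using (Fin; zero; suc)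
open import Data.Fin.Properties using (_≟_; all?; any?)
open import Data.Fin.Subset.Properties using (anySubset?)
open import Data.Vec using (lookup; tabulate)
open import Data.Vec.Properties using (lookup∘tabulate)
import Data.Vec.Functional as Vector
open import Data.Maybe using (Maybe; just; nothing)
open import Data.List using (List; []; _∷_; _++_; allFin; length)
open import Data.List.Properties using (length-tabulate)
open import Data.List.Membership.Propositional using (_∈_)
open import Data.List.Membership.Propositional.Properties using (∈-++⁺ˡ; ∈-++⁺ʳ; ∈-allFin)
open import Data.List.Relation.Unary.Any using (here; there)
open import Data.List.Relation.Unary.All using (All; _∷_) renaming (lookup to lookupAll)
import Data.List.Relation.Unary.All.Properties as All
open import Data.List.Relation.Unary.AllPairs using ([]; _∷_)
open import Data.List.Relation.Unary.Unique.Propositional using (Unique)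
open import Data.Product using (Σ; ∃; _×_; _,_; proj₁; proj₂)
open import Data.Sum using (_⊎_; inj₁; inj₂)
open import Data.Empty using (⊥; ⊥-elim)
open import Relation.Nullary using (Dec; yes; no; does)
open import Relation.Nullary.Decidable using (map′; _×-dec_; _→-dec_; ¬?)
open import Function using (_∘_; id)
open import Relation.Binary.PropositionalEquality

true≢false : true ≢ false
true≢false ()

≢true⇒≡false : ∀ {x} → x ≢ true → x ≡ false
≢true⇒≡false {true}  x≢true = ⊥-elim (x≢true refl)
≢true⇒≡false {false} _      = refl

true-or-false : (x : Bool) → x ≡ true ⊎ x ≡ false
true-or-false true  = inj₁ refl
true-or-false false = inj₂ refl

∨≡true⇒ : ∀ {x y} → x ∨ y ≡ true → x ≡ true ⊎ y ≡ true
∨≡true⇒ {true}  _ = inj₁ refl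
∨≡true⇒ {false} e = inj₂ e

∧≡true⇒ : ∀ {x y} → x ∧ y ≡ true → x ≡ true × y ≡ true
∧≡true⇒ {true} e = refl , e

∧≡false⇒ : ∀ {x y} → x ∧ y ≡ false → x ≡ false ⊎ y ≡ false
∧≡false⇒ {false} _ = inj₁ refl
∧≡false⇒ {true}  e = inj₂ e

∨≡false⇒ : ∀ {x y} → x ∨ y ≡ false → x ≡ false × y ≡ false
∨≡false⇒ {false} e = refl , e

not≡true⇒ : ∀ {x} → not x ≡ true → x ≡ false
not≡true⇒ {false} _ = refl

true-unless-false : ∀ {x} → (x ≡ false → x ≡ true) → x ≡ true
true-unless-false {true}  _ = refl
true-unless-false {false} h = h refl

∧-trueʳ : ∀ x {y} → y ≡ true → x ∧ y ≡ x
∧-trueʳ x refl = ∧-identityʳ x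

∨-falseʳ : ∀ x {y} → y ≡ false → x ∨ y ≡ x
∨-falseʳ x refl = ∨-identityʳ x

∨-introˡ : ∀ {x y} → x ≡ true → x ∨ y ≡ true
∨-introˡ refl = refl

∨-introʳ : ∀ {x y} → y ≡ true → x ∨ y ≡ true
∨-introʳ {x} refl = ∨-zeroʳ x

infix 8 _==_

_==_ : ∀ {n} → Fin n → Fin n → Bool
m == k = does (m ≟ k)

==-refl : ∀ {n} (k : Fin n) → k == k ≡ true
==-refl k with k ≟ k
... | yes _   = refl
... | no k≢k = ⊥-elim (k≢k refl)

==-≢ : ∀ {n} {m k : Fin n} → m ≢ k → m == k ≡ false
==-≢ {m = m} {k} m≢k with m ≟ k
... | yes m≡k = ⊥-elim (m≢k m≡k)
... | no _    = refl

==⇒≡ : ∀ {n} {m k : Fin n} → m == k ≡ true → m ≡ k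
==⇒≡ {m = m} {k} e with m ≟ k
... | yes m≡k = m≡k

==-suc : ∀ {n} (i k : Fin n) → suc i == suc k ≡ i == k
==-suc i k with i ≟ k
... | yes refl = refl
... | no _     = refl

update : ∀ {n} → Assignment n → Fin n → Bool → Assignment n
update a k b m = if m == k then b else a m

update-same : ∀ {n} (a : Assignment n) k b → update a k b k ≡ b
update-same a k b rewrite ==-refl k = refl

update-other : ∀ {n} (a : Assignment n) {k m} b → m ≢ k → update a k b m ≡ a m
update-other a b m≢k rewrite ==-≢ m≢k = refl

update-update : ∀ {n} (a : Assignment n) k v w m → update (update a k v) k w m ≡ update a k w m
update-update a k v w m with m == k
... | true  = refl
... | false = refl

update-id : ∀ {n} (a : Assignment n) k m → update a k (a k) m ≡ a m
update-id a k m with m == k in e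
... | true  = cong a (sym (==⇒≡ e))
... | false = refl

infix 4 _≤ₐ_

_≤ₐ_ : ∀ {n} → Assignment n → Assignment n → Set
a ≤ₐ b = ∀ m → a m ≡ true → b m ≡ true

≤ₐ-update-true : ∀ {n} (a : Assignment n) m → a ≤ₐ update a m true
≤ₐ-update-true a m m′ p with m′ == m
... | true  = refl
... | false = p

update-false-≤ₐ : ∀ {n} (a : Assignment n) m → update a m false ≤ₐ a
update-false-≤ₐ a m m′ p with m′ == m
... | true  = ⊥-elim (true≢false (sym p))
... | false = p

Monotone : ∀ {n} → BoolFun n → Set
Monotone F = ∀ {a b} → a ≤ₐ b → F a ≡ true → F b ≡ true

Monotone-cong : ∀ {n} {F G : BoolFun n} → (∀ a → F a ≡ G a) → Monotone F → Monotone G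
Monotone-cong F≗G mono {a} {b} a≤b Ga = trans (sym (F≗G b)) (mono a≤b (trans (F≗G a) Ga))

antimono : ∀ {n} {F : BoolFun n} → Monotone F → ∀ {a b} → a ≤ₐ b → F b ≡ false → F a ≡ false
antimono mono a≤b Fb = ≢true⇒≡false λ Fa → true≢false (trans (sym (mono a≤b Fa)) Fb)

monotone-ext : ∀ {n} {F : BoolFun n} → Monotone F → ∀ {a b} → (∀ m → a m ≡ b m) → F a ≡ F b
monotone-ext {F = F} mono {a} {b} a≗b with F a in Fa | F b in Fb
... | true  | true  = refl
... | false | false = refl
... | true  | false = trans (sym (mono (λ m p → trans (sym (a≗b m)) p) Fa)) Fb
... | false | true  = trans (sym Fa) (mono (λ m p → trans (a≗b m) p) Fb)

update-mono : ∀ {n} {a b : Assignment n} m v → a ≤ₐ b → update a m v ≤ₐ update b m v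
update-mono m v a≤b m′ p with m′ == m
... | true  = p
... | false = a≤b m′ p

occurs : ∀ {n} → Formula n → Fin n → Bool
occurs (var i)    m = m == i
occurs (and′ φ ψ) m = occurs φ m ∨ occurs ψ m
occurs (or′ φ ψ)  m = occurs φ m ∨ occurs ψ m

Disjoint : ∀ {n} → Formula n → Formula n → Set
Disjoint φ ψ = ∀ m → occurs φ m ≡ true → occurs ψ m ≡ false

ReadOnceTree : ∀ {n} → Formula n → Set
ReadOnceTree (var i)    = ⊤
ReadOnceTree (and′ φ ψ) = ReadOnceTree φ × ReadOnceTree ψ × Disjoint φ ψ
ReadOnceTree (or′ φ ψ)  = ReadOnceTree φ × ReadOnceTree ψ × Disjoint φ ψ

module _ {n} (φ ψ : Formula n) where

  inLeft : ∀ {m} → occurs φ m ≡ true → occurs φ m ∨ occurs ψ m ≡ true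
  inLeft = ∨-introˡ

  inRight : ∀ {m} → occurs ψ m ≡ true → occurs φ m ∨ occurs ψ m ≡ true
  inRight {m} = ∨-introʳ {occurs φ m}

  notLeft⇒right : ∀ {m} → occurs φ m ∨ occurs ψ m ≡ true → occurs φ m ≡ false → occurs ψ m ≡ true
  notLeft⇒right e φm rewrite φm = e

  notRight⇒left : ∀ {m} → occurs φ m ∨ occurs ψ m ≡ true → occurs ψ m ≡ false → occurs φ m ≡ true
  notRight⇒left {m} e ψm rewrite ψm = trans (sym (∨-identityʳ (occurs φ m))) e

  Disjoint-sym : Disjoint φ ψ → Disjoint ψ φ
  Disjoint-sym φ#ψ m ψm = ≢true⇒≡false λ φm → true≢false (trans (sym ψm) (φ#ψ m φm))

occurs⇒∈ : ∀ {n} (φ : Formula n) m → occurs φ m ≡ true → m ∈ occurrences φ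
occurs⇒∈ (var i)    m e = here (==⇒≡ e)
occurs⇒∈ (and′ φ ψ) m e with ∨≡true⇒ {occurs φ m} e
... | inj₁ φm = ∈-++⁺ˡ (occurs⇒∈ φ m φm)
... | inj₂ ψm = ∈-++⁺ʳ (occurrences φ) (occurs⇒∈ ψ m ψm)
occurs⇒∈ (or′ φ ψ)  m e with ∨≡true⇒ {occurs φ m} e
... | inj₁ φm = ∈-++⁺ˡ (occurs⇒∈ φ m φm)
... | inj₂ ψm = ∈-++⁺ʳ (occurrences φ) (occurs⇒∈ ψ m ψm)

Unique-++⁻ : ∀ {n} (xs ys : List (Fin n)) → Unique (xs ++ ys) →
             Unique xs × Unique ys × (∀ {m} → m ∈ xs → m ∈ ys → ⊥)
Unique-++⁻ []       ys u        = [] , u , λ ()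
Unique-++⁻ (x ∷ xs) ys (x∉ ∷ u) with Unique-++⁻ xs ys u | All.++⁻ xs x∉
... | uxs , uys , xs#ys | x∉xs , x∉ys = (x∉xs ∷ uxs) , uys , disjoint
  where
  disjoint : ∀ {m} → m ∈ x ∷ xs → m ∈ ys → ⊥
  disjoint (here refl) m∈ys = lookupAll x∉ys m∈ys refl
  disjoint (there m∈xs) m∈ys = xs#ys m∈xs m∈ys

Disjoint-from-occurrences : ∀ {n} (φ ψ : Formula n) →
  (∀ {m} → m ∈ occurrences φ → m ∈ occurrences ψ → ⊥) → Disjoint φ ψ
Disjoint-from-occurrences φ ψ φ#ψ m φm =
  ≢true⇒≡false λ ψm → φ#ψ (occurs⇒∈ φ m φm) (occurs⇒∈ ψ m ψm)

readOnceTree : ∀ {n} (φ : Formula n) → ReadOnceFormula φ → ReadOnceTree φ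
readOnceTree (var i)    _ = tt
readOnceTree (and′ φ ψ) u with Unique-++⁻ (occurrences φ) (occurrences ψ) u
... | uφ , uψ , φ#ψ = readOnceTree φ uφ , readOnceTree ψ uψ , Disjoint-from-occurrences φ ψ φ#ψ
readOnceTree (or′ φ ψ)  u with Unique-++⁻ (occurrences φ) (occurrences ψ) u
... | uφ , uψ , φ#ψ = readOnceTree φ uφ , readOnceTree ψ uψ , Disjoint-from-occurrences φ ψ φ#ψ

eval-cong : ∀ {n} (φ : Formula n) {a b} → (∀ m → occurs φ m ≡ true → a m ≡ b m) → eval φ a ≡ eval φ b
eval-cong (var i)    a≗b = a≗b i (==-refl i)
eval-cong (and′ φ ψ) a≗b = cong₂ _∧_ (eval-cong φ λ m p → a≗b m (inLeft φ ψ p))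
                                     (eval-cong ψ λ m p → a≗b m (inRight φ ψ p))
eval-cong (or′ φ ψ)  a≗b = cong₂ _∨_ (eval-cong φ λ m p → a≗b m (inLeft φ ψ p))
                                     (eval-cong ψ λ m p → a≗b m (inRight φ ψ p))

occurs-≢ : ∀ {n} (φ : Formula n) {m k} → occurs φ m ≡ true → occurs φ k ≡ false → m ≢ k
occurs-≢ φ φm φk refl = true≢false (trans (sym φm) φk)

eval-update-absent : ∀ {n} (φ : Formula n) {a k} b → occurs φ k ≡ false → eval φ (update a k b) ≡ eval φ a
eval-update-absent φ {a} b φk = eval-cong φ λ m φm → update-other a b (occurs-≢ φ φm φk)

eval-mono-on : ∀ {n} (φ : Formula n) {a b} → (∀ m → occurs φ m ≡ true → a m ≡ true → b m ≡ true) →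
               eval φ a ≡ true → eval φ b ≡ true
eval-mono-on (var i)    a≤b e = a≤b i (==-refl i) e
eval-mono-on (and′ φ ψ) a≤b e with ∧≡true⇒ {eval φ _} e
... | p , q rewrite eval-mono-on φ (λ m φm → a≤b m (inLeft φ ψ φm)) p
                  | eval-mono-on ψ (λ m ψm → a≤b m (inRight φ ψ ψm)) q = refl
eval-mono-on (or′ φ ψ) {a} a≤b e with ∨≡true⇒ {eval φ a} e
... | inj₁ p = ∨-introˡ (eval-mono-on φ (λ m φm → a≤b m (inLeft φ ψ φm)) p)
... | inj₂ q = ∨-introʳ (eval-mono-on ψ (λ m ψm → a≤b m (inRight φ ψ ψm)) q)

eval-antimono-on : ∀ {n} (φ : Formula n) {a b} → (∀ m → occurs φ m ≡ true → a m ≡ true → b m ≡ true) →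
                   eval φ b ≡ false → eval φ a ≡ false
eval-antimono-on φ a≤b φb = ≢true⇒≡false λ φa → true≢false (trans (sym (eval-mono-on φ a≤b φa)) φb)

eval-mono : ∀ {n} (φ : Formula n) → Monotone (eval φ)
eval-mono φ a≤b = eval-mono-on φ (λ m _ → a≤b m)

true-witness : ∀ {n} (φ : Formula n) {a} → eval φ a ≡ true → Σ (Fin n) λ m → occurs φ m ≡ true × a m ≡ true
true-witness (var i)    e = i , ==-refl i , e
true-witness (and′ φ ψ) e with true-witness φ (proj₁ (∧≡true⇒ e))
... | m , φm , am = m , inLeft φ ψ φm , am
true-witness (or′ φ ψ) {a} e with ∨≡true⇒ {eval φ a} e
... | inj₁ x with true-witness φ x
...   | m , φm , am = m , inLeft φ ψ φm , am
true-witness (or′ φ ψ) {a} e | inj₂ y with true-witness ψ y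
...   | m , ψm , am = m , inRight φ ψ ψm , am

false-witness : ∀ {n} (φ : Formula n) {a} → eval φ a ≡ false → Σ (Fin n) λ m → occurs φ m ≡ true × a m ≡ false
false-witness (var i)    e = i , ==-refl i , e
false-witness (or′ φ ψ)  e with false-witness φ (proj₁ (∨≡false⇒ e))
... | m , φm , am = m , inLeft φ ψ φm , am
false-witness (and′ φ ψ) {a} e with ∧≡false⇒ {eval φ a} e
... | inj₁ x with false-witness φ x
...   | m , φm , am = m , inLeft φ ψ φm , am
false-witness (and′ φ ψ) {a} e | inj₂ y with false-witness ψ y
...   | m , ψm , am = m , inRight φ ψ ψm , am

eval-all-true : ∀ {n} (φ : Formula n) {a} → (∀ m → occurs φ m ≡ true → a m ≡ true) → eval φ a ≡ true
eval-all-true φ {a} h with eval φ a in e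
... | true  = refl
... | false with false-witness φ e
...   | m , φm , am = trans (sym am) (h m φm)

eval-all-false : ∀ {n} (φ : Formula n) {a} → (∀ m → occurs φ m ≡ true → a m ≡ false) → eval φ a ≡ false
eval-all-false φ {a} h with eval φ a in e
... | false = refl
... | true with true-witness φ e
...   | m , φm , am = trans (sym am) (h m φm)

-- The ∧-relation of a read-once formula

-- ∧-linked φ s t: s and t occur in φ and their lowest common ancestor is an ∧-node.
∧-linked : ∀ {n} → Formula n → Fin n → Fin n → Bool
∧-linked (var i)    s t = false
∧-linked (and′ φ ψ) s t = ∧-linked φ s t ∨ ∧-linked ψ s t ∨ (occurs φ s ∧ occurs ψ t) ∨ (occurs ψ s ∧ occurs φ t)
∧-linked (or′ φ ψ)  s t = ∧-linked φ s t ∨ ∧-linked ψ s t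

∧-linked⇒occurs : ∀ {n} (φ : Formula n) {s t} → ∧-linked φ s t ≡ true → occurs φ s ≡ true × occurs φ t ≡ true
∧-linked⇒occurs (var i) ()
∧-linked⇒occurs (and′ φ ψ) {s} {t} e with ∨≡true⇒ {∧-linked φ s t} e
... | inj₁ p = inLeft φ ψ (proj₁ (∧-linked⇒occurs φ p)) , inLeft φ ψ (proj₂ (∧-linked⇒occurs φ p))
... | inj₂ e′ with ∨≡true⇒ {∧-linked ψ s t} e′
...   | inj₁ p = inRight φ ψ (proj₁ (∧-linked⇒occurs ψ p)) , inRight φ ψ (proj₂ (∧-linked⇒occurs ψ p))
...   | inj₂ e″ with ∨≡true⇒ {occurs φ s ∧ occurs ψ t} e″
...     | inj₁ p = inLeft φ ψ (proj₁ (∧≡true⇒ p)) , inRight φ ψ (proj₂ (∧≡true⇒ p))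
...     | inj₂ p = inRight φ ψ (proj₁ (∧≡true⇒ p)) , inLeft φ ψ (proj₂ (∧≡true⇒ p))
∧-linked⇒occurs (or′ φ ψ) {s} {t} e with ∨≡true⇒ {∧-linked φ s t} e
... | inj₁ p = inLeft φ ψ (proj₁ (∧-linked⇒occurs φ p)) , inLeft φ ψ (proj₂ (∧-linked⇒occurs φ p))
... | inj₂ p = inRight φ ψ (proj₁ (∧-linked⇒occurs ψ p)) , inRight φ ψ (proj₂ (∧-linked⇒occurs ψ p))

∧-linked-absentˡ : ∀ {n} (φ : Formula n) {s t} → occurs φ s ≡ false → ∧-linked φ s t ≡ false
∧-linked-absentˡ φ φs = ≢true⇒≡false λ p → true≢false (trans (sym (proj₁ (∧-linked⇒occurs φ p))) φs)

∧-linked-absentʳ : ∀ {n} (φ : Formula n) {s t} → occurs φ t ≡ false → ∧-linked φ s t ≡ false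
∧-linked-absentʳ φ φt = ≢true⇒≡false λ p → true≢false (trans (sym (proj₂ (∧-linked⇒occurs φ p))) φt)

module _ {n} (φ ψ : Formula n) (φ#ψ : Disjoint φ ψ) {s t : Fin n} where

  ∧-linked-andˡ : occurs φ s ≡ true → ∧-linked (and′ φ ψ) s t ≡ ∧-linked φ s t ∨ occurs ψ t
  ∧-linked-andˡ φs rewrite ∧-linked-absentˡ ψ {s} {t} (φ#ψ s φs) | φ#ψ s φs | φs =
    cong (∧-linked φ s t ∨_) (∨-identityʳ (occurs ψ t))

  ∧-linked-andʳ : occurs ψ s ≡ true → ∧-linked (and′ φ ψ) s t ≡ ∧-linked ψ s t ∨ occurs φ t
  ∧-linked-andʳ ψs rewrite ∧-linked-absentˡ φ {s} {t} (Disjoint-sym φ ψ φ#ψ s ψs)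
                         | Disjoint-sym φ ψ φ#ψ s ψs | ψs = refl

  ∧-linked-orˡ : occurs φ s ≡ true → ∧-linked (or′ φ ψ) s t ≡ ∧-linked φ s t
  ∧-linked-orˡ φs rewrite ∧-linked-absentˡ ψ {s} {t} (φ#ψ s φs) = ∨-identityʳ (∧-linked φ s t)

  ∧-linked-orʳ : occurs ψ s ≡ true → ∧-linked (or′ φ ψ) s t ≡ ∧-linked ψ s t
  ∧-linked-orʳ ψs rewrite ∧-linked-absentˡ φ {s} {t} (Disjoint-sym φ ψ φ#ψ s ψs) = refl

  ∧-linked-and-withinˡ : occurs φ s ≡ true → occurs φ t ≡ true → ∧-linked (and′ φ ψ) s t ≡ ∧-linked φ s t
  ∧-linked-and-withinˡ φs φt rewrite ∧-linked-andˡ φs | φ#ψ t φt = ∨-identityʳ (∧-linked φ s t)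

  ∧-linked-and-withinʳ : occurs ψ s ≡ true → occurs ψ t ≡ true → ∧-linked (and′ φ ψ) s t ≡ ∧-linked ψ s t
  ∧-linked-and-withinʳ ψs ψt rewrite ∧-linked-andʳ ψs | Disjoint-sym φ ψ φ#ψ t ψt = ∨-identityʳ (∧-linked ψ s t)

  ∧-linked-acrossˡ : occurs φ s ≡ true → occurs ψ t ≡ true → ∧-linked (and′ φ ψ) s t ≡ true
  ∧-linked-acrossˡ φs ψt = trans (∧-linked-andˡ φs) (∨-introʳ ψt)

  ∧-linked-acrossʳ : occurs ψ s ≡ true → occurs φ t ≡ true → ∧-linked (and′ φ ψ) s t ≡ true
  ∧-linked-acrossʳ ψs φt = trans (∧-linked-andʳ ψs) (∨-introʳ φt)

record MaximalFalse {n} (F : BoolFun n) (R : Fin n → Bool) (k : Fin n) (c : Assignment n) : Set where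
  constructor maxFalse
  field
    off     : c k ≡ false
    rejects : F c ≡ false
    raise   : ∀ m → R m ≡ true → c m ≡ false → F (update c m true) ≡ true

record MinimalTrue {n} (F : BoolFun n) (R : Fin n → Bool) (k : Fin n) (d : Assignment n) : Set where
  constructor minTrue
  field
    on      : d k ≡ true
    accepts : F d ≡ true
    lower   : ∀ m → R m ≡ true → d m ≡ true → F (update d m false) ≡ false

open MaximalFalse
open MinimalTrue

MaxFalse : ∀ {n} → Formula n → Fin n → Assignment n → Set
MaxFalse φ = MaximalFalse (eval φ) (occurs φ)

MinTrue : ∀ {n} → Formula n → Fin n → Assignment n → Set
MinTrue φ = MinimalTrue (eval φ) (occurs φ)


module _ {n} (φ ψ : Formula n) (φ#ψ : Disjoint φ ψ) {k : Fin n} where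

  private
    ψ#φ = Disjoint-sym φ ψ φ#ψ

  MaxFalse-andˡ : ∀ {c} → occurs φ k ≡ true → MaxFalse (and′ φ ψ) k c → MaxFalse φ k c × eval ψ c ≡ true
  MaxFalse-andˡ {c} φk (maxFalse ck ev raise) = maxFalse ck φc (λ m p q → proj₁ (∧≡true⇒ (raise m (inLeft φ ψ p) q))) , ψc
    where
    ψc : eval ψ c ≡ true
    ψc = trans (sym (eval-update-absent ψ true (φ#ψ k φk))) (proj₂ (∧≡true⇒ (raise k (inLeft φ ψ φk) ck)))
    φc : eval φ c ≡ false
    φc with ∧≡false⇒ {eval φ c} ev
    ... | inj₁ x = x
    ... | inj₂ y = ⊥-elim (true≢false (trans (sym ψc) y))

  MaxFalse-andʳ : ∀ {c} → occurs ψ k ≡ true → MaxFalse (and′ φ ψ) k c → MaxFalse ψ k c × eval φ c ≡ true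
  MaxFalse-andʳ {c} ψk (maxFalse ck ev raise) =
    maxFalse ck ψc (λ m p q → proj₂ (∧≡true⇒ {eval φ (update c m true)} (raise m (inRight φ ψ p) q))) , φc
    where
    φc : eval φ c ≡ true
    φc = trans (sym (eval-update-absent φ true (ψ#φ k ψk))) (proj₁ (∧≡true⇒ (raise k (inRight φ ψ ψk) ck)))
    ψc : eval ψ c ≡ false
    ψc with ∧≡false⇒ {eval φ c} ev
    ... | inj₂ y = y
    ... | inj₁ x = ⊥-elim (true≢false (trans (sym φc) x))

  MaxFalse-orˡ : ∀ {c} → occurs φ k ≡ true → MaxFalse (or′ φ ψ) k c → MaxFalse φ k c × eval ψ c ≡ false
  MaxFalse-orˡ {c} φk (maxFalse ck ev raise) = maxFalse ck (proj₁ (∨≡false⇒ ev)) raiseφ , ψc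
    where
    ψc = proj₂ (∨≡false⇒ ev)
    raiseφ : ∀ m → occurs φ m ≡ true → c m ≡ false → eval φ (update c m true) ≡ true
    raiseφ m p q with ∨≡true⇒ {eval φ (update c m true)} (raise m (inLeft φ ψ p) q)
    ... | inj₁ x = x
    ... | inj₂ y = ⊥-elim (true≢false (trans (sym y) (trans (eval-update-absent ψ true (φ#ψ m p)) ψc)))

  MaxFalse-orʳ : ∀ {c} → occurs ψ k ≡ true → MaxFalse (or′ φ ψ) k c → MaxFalse ψ k c × eval φ c ≡ false
  MaxFalse-orʳ {c} ψk (maxFalse ck ev raise) = maxFalse ck (proj₂ (∨≡false⇒ {eval φ c} ev)) raiseψ , φc
    where
    φc = proj₁ (∨≡false⇒ ev)
    raiseψ : ∀ m → occurs ψ m ≡ true → c m ≡ false → eval ψ (update c m true) ≡ true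
    raiseψ m p q with ∨≡true⇒ {eval φ (update c m true)} (raise m (inRight φ ψ p) q)
    ... | inj₂ y = y
    ... | inj₁ x = ⊥-elim (true≢false (trans (sym x) (trans (eval-update-absent φ true (ψ#φ m p)) φc)))

  MinTrue-andˡ : ∀ {d} → occurs φ k ≡ true → MinTrue (and′ φ ψ) k d → MinTrue φ k d × eval ψ d ≡ true
  MinTrue-andˡ {d} φk (minTrue dk ev lower) = minTrue dk (proj₁ (∧≡true⇒ ev)) lowerφ , ψd
    where
    ψd = proj₂ (∧≡true⇒ ev)
    lowerφ : ∀ m → occurs φ m ≡ true → d m ≡ true → eval φ (update d m false) ≡ false
    lowerφ m p q with ∧≡false⇒ {eval φ (update d m false)} (lower m (inLeft φ ψ p) q)
    ... | inj₁ x = x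
    ... | inj₂ y = ⊥-elim (true≢false (trans (sym ψd) (trans (sym (eval-update-absent ψ false (φ#ψ m p))) y)))

  MinTrue-andʳ : ∀ {d} → occurs ψ k ≡ true → MinTrue (and′ φ ψ) k d → MinTrue ψ k d × eval φ d ≡ true
  MinTrue-andʳ {d} ψk (minTrue dk ev lower) = minTrue dk (proj₂ (∧≡true⇒ {eval φ d} ev)) lowerψ , φd
    where
    φd = proj₁ (∧≡true⇒ ev)
    lowerψ : ∀ m → occurs ψ m ≡ true → d m ≡ true → eval ψ (update d m false) ≡ false
    lowerψ m p q with ∧≡false⇒ {eval φ (update d m false)} (lower m (inRight φ ψ p) q)
    ... | inj₂ y = y
    ... | inj₁ x = ⊥-elim (true≢false (trans (sym φd) (trans (sym (eval-update-absent φ false (ψ#φ m p))) x)))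

  MinTrue-orˡ : ∀ {d} → occurs φ k ≡ true → MinTrue (or′ φ ψ) k d → MinTrue φ k d × eval ψ d ≡ false
  MinTrue-orˡ {d} φk (minTrue dk ev lower) = minTrue dk φd (λ m p q → proj₁ (∨≡false⇒ (lower m (inLeft φ ψ p) q))) , ψd
    where
    ψd : eval ψ d ≡ false
    ψd = trans (sym (eval-update-absent ψ false (φ#ψ k φk))) (proj₂ (∨≡false⇒ (lower k (inLeft φ ψ φk) dk)))
    φd : eval φ d ≡ true
    φd with ∨≡true⇒ {eval φ d} ev
    ... | inj₁ x = x
    ... | inj₂ y = ⊥-elim (true≢false (trans (sym y) ψd))

  MinTrue-orʳ : ∀ {d} → occurs ψ k ≡ true → MinTrue (or′ φ ψ) k d → MinTrue ψ k d × eval φ d ≡ false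
  MinTrue-orʳ {d} ψk (minTrue dk ev lower) =
    minTrue dk ψd (λ m p q → proj₂ (∨≡false⇒ {eval φ (update d m false)} (lower m (inRight φ ψ p) q))) , φd
    where
    φd : eval φ d ≡ false
    φd = trans (sym (eval-update-absent φ false (ψ#φ k ψk))) (proj₁ (∨≡false⇒ (lower k (inRight φ ψ ψk) dk)))
    ψd : eval ψ d ≡ true
    ψd with ∨≡true⇒ {eval φ d} ev
    ... | inj₂ y = y
    ... | inj₁ x = ⊥-elim (true≢false (trans (sym x) φd))

  MaxFalse-and-onʳ : ∀ {c} → occurs φ k ≡ true → MaxFalse (and′ φ ψ) k c → ∀ m → occurs ψ m ≡ true → c m ≡ true
  MaxFalse-and-onʳ {c} φk M m ψm with c m in cm
  ... | true  = refl
  ... | false = ⊥-elim (true≢false (trans (sym (proj₁ (∧≡true⇒ (raise M m (inRight φ ψ ψm) cm))))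
                                          (trans (eval-update-absent φ true (ψ#φ m ψm)) (rejects (proj₁ (MaxFalse-andˡ φk M))))))

  MaxFalse-and-onˡ : ∀ {c} → occurs ψ k ≡ true → MaxFalse (and′ φ ψ) k c → ∀ m → occurs φ m ≡ true → c m ≡ true
  MaxFalse-and-onˡ {c} ψk M m φm with c m in cm
  ... | true  = refl
  ... | false = ⊥-elim (true≢false (trans (sym (proj₂ (∧≡true⇒ {eval φ (update c m true)} (raise M m (inLeft φ ψ φm) cm))))
                                          (trans (eval-update-absent ψ true (φ#ψ m φm)) (rejects (proj₁ (MaxFalse-andʳ ψk M))))))

MaxFalse-∧-linked : ∀ {n} (φ : Formula n) → ReadOnceTree φ → ∀ {k c m} →
                    MaxFalse φ k c → occurs φ k ≡ true → ∧-linked φ k m ≡ true → c m ≡ true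
MaxFalse-∧-linked (var i) _ _ _ ()
MaxFalse-∧-linked (and′ φ ψ) (roφ , roψ , φ#ψ) {k} {c} {m} M k∈ e with true-or-false (occurs φ k)
... | inj₁ φk with ∨≡true⇒ {∧-linked φ k m} (trans (sym (∧-linked-andˡ φ ψ φ#ψ φk)) e)
...   | inj₁ l  = MaxFalse-∧-linked φ roφ (proj₁ (MaxFalse-andˡ φ ψ φ#ψ φk M)) φk l
...   | inj₂ ψm = MaxFalse-and-onʳ φ ψ φ#ψ φk M m ψm
MaxFalse-∧-linked (and′ φ ψ) (roφ , roψ , φ#ψ) {k} {c} {m} M k∈ e | inj₂ ¬φk
  with notLeft⇒right φ ψ k∈ ¬φk
... | ψk with ∨≡true⇒ {∧-linked ψ k m} (trans (sym (∧-linked-andʳ φ ψ φ#ψ ψk)) e)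
...   | inj₁ l  = MaxFalse-∧-linked ψ roψ (proj₁ (MaxFalse-andʳ φ ψ φ#ψ ψk M)) ψk l
...   | inj₂ φm = MaxFalse-and-onˡ φ ψ φ#ψ ψk M m φm
MaxFalse-∧-linked (or′ φ ψ) (roφ , roψ , φ#ψ) M k∈ e with true-or-false (occurs φ _)
... | inj₁ φk = MaxFalse-∧-linked φ roφ (proj₁ (MaxFalse-orˡ φ ψ φ#ψ φk M)) φk
                  (trans (sym (∧-linked-orˡ φ ψ φ#ψ φk)) e)
... | inj₂ ¬φk with notLeft⇒right φ ψ k∈ ¬φk
...   | ψk = MaxFalse-∧-linked ψ roψ (proj₁ (MaxFalse-orʳ φ ψ φ#ψ ψk M)) ψk
                  (trans (sym (∧-linked-orʳ φ ψ φ#ψ ψk)) e)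

-- Detecting the ∧-relation with one membership query per pair

pairPoint : ∀ {n} → Assignment n → Assignment n → Fin n → Fin n → Assignment n
pairPoint ci cj i j m = (ci m ∧ cj m) ∨ (m == i ∨ m == j)

module _ {n} (ci cj : Assignment n) (i j : Fin n) where

  private
    W = pairPoint ci cj i j

  pairPoint-≤ʳ : cj i ≡ true → ∀ {m} → m ≢ j → W m ≡ true → cj m ≡ true
  pairPoint-≤ʳ cji {m} m≢j e rewrite ==-≢ m≢j with ∨≡true⇒ {ci m ∧ cj m} e
  ... | inj₁ x = proj₂ (∧≡true⇒ x)
  ... | inj₂ y = subst (λ x → cj x ≡ true) (sym (==⇒≡ (trans (sym (∨-identityʳ (m == i))) y))) cji

  pairPoint-≤ˡ : ci j ≡ true → ∀ {m} → m ≢ i → W m ≡ true → ci m ≡ true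
  pairPoint-≤ˡ cij {m} m≢i e rewrite ==-≢ m≢i with ∨≡true⇒ {ci m ∧ cj m} e
  ... | inj₁ x = proj₁ (∧≡true⇒ x)
  ... | inj₂ y = subst (λ x → ci x ≡ true) (sym (==⇒≡ y)) cij

  pairPoint-≤-both : ∀ {m} → m ≢ i → m ≢ j → W m ≡ true → ci m ≡ true
  pairPoint-≤-both {m} m≢i m≢j e rewrite ==-≢ m≢i | ==-≢ m≢j =
    proj₁ (∧≡true⇒ (trans (sym (∨-identityʳ (ci m ∧ cj m))) e))

  pairPoint-≡ˡ : ∀ {m} → cj m ≡ true → m ≢ j → W m ≡ update ci i true m
  pairPoint-≡ˡ {m} cjm m≢j rewrite cjm | ==-≢ m≢j | ∧-identityʳ (ci m) with m == i
  ... | true  = ∨-zeroʳ (ci m)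
  ... | false = ∨-identityʳ (ci m)

  pairPoint-≡ʳ : ∀ {m} → ci m ≡ true → m ≢ i → W m ≡ update cj j true m
  pairPoint-≡ʳ {m} cim m≢i rewrite cim | ==-≢ m≢i with m == j
  ... | true  = ∨-zeroʳ (cj m)
  ... | false = ∨-identityʳ (cj m)

  pairPoint-true : ∀ {m} → ci m ≡ true → cj m ≡ true → W m ≡ true
  pairPoint-true cim cjm rewrite cim | cjm = refl

  pairPoint-raisesˡ : (χ : Formula n) → occurs χ j ≡ false → (∀ m → occurs χ m ≡ true → cj m ≡ true) →
                      MaxFalse χ i ci → occurs χ i ≡ true → eval χ W ≡ true
  pairPoint-raisesˡ χ χj cj-on M χi =
    trans (eval-cong χ λ m χm → pairPoint-≡ˡ (cj-on m χm) (occurs-≢ χ χm χj)) (raise M i χi (off M))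

  pairPoint-raisesʳ : (χ : Formula n) → occurs χ i ≡ false → (∀ m → occurs χ m ≡ true → ci m ≡ true) →
                      MaxFalse χ j cj → occurs χ j ≡ true → eval χ W ≡ true
  pairPoint-raisesʳ χ χi ci-on M χj =
    trans (eval-cong χ λ m χm → pairPoint-≡ʳ (ci-on m χm) (occurs-≢ χ χm χi)) (raise M j χj (off M))

  pairPoint-all-on : (χ : Formula n) → (∀ m → occurs χ m ≡ true → ci m ≡ true) → (∀ m → occurs χ m ≡ true → cj m ≡ true) →
                     eval χ W ≡ true
  pairPoint-all-on χ ci-on cj-on = eval-all-true χ λ m χm → pairPoint-true (ci-on m χm) (cj-on m χm)

  pairPoint-rejectsʳ : (χ : Formula n) → cj i ≡ true → occurs χ j ≡ false → eval χ cj ≡ false → eval χ W ≡ false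
  pairPoint-rejectsʳ χ cji χj = eval-antimono-on χ λ m χm → pairPoint-≤ʳ cji (occurs-≢ χ χm χj)

  pairPoint-rejectsˡ : (χ : Formula n) → ci j ≡ true → occurs χ i ≡ false → eval χ ci ≡ false → eval χ W ≡ false
  pairPoint-rejectsˡ χ cij χi = eval-antimono-on χ λ m χm → pairPoint-≤ˡ cij (occurs-≢ χ χm χi)

  pairPoint-rejects-both : (χ : Formula n) → occurs χ i ≡ false → occurs χ j ≡ false → eval χ ci ≡ false → eval χ W ≡ false
  pairPoint-rejects-both χ χi χj = eval-antimono-on χ λ m χm → pairPoint-≤-both (occurs-≢ χ χm χi) (occurs-≢ χ χm χj)

∧-linked-pairPoint : ∀ {n} (φ : Formula n) → ReadOnceTree φ → ∀ {i j ci cj} →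
  occurs φ i ≡ true → occurs φ j ≡ true → i ≢ j → MaxFalse φ i ci → MaxFalse φ j cj →
  ∧-linked φ i j ≡ cj i ∧ ci j ∧ eval φ (pairPoint ci cj i j)

∧-linked-pairPoint-and : ∀ {n} (φ ψ : Formula n) → ReadOnceTree (and′ φ ψ) → ∀ {i j ci cj} →
  occurs (and′ φ ψ) i ≡ true → occurs (and′ φ ψ) j ≡ true → i ≢ j → MaxFalse (and′ φ ψ) i ci → MaxFalse (and′ φ ψ) j cj →
  ∧-linked (and′ φ ψ) i j ≡ cj i ∧ ci j ∧ eval (and′ φ ψ) (pairPoint ci cj i j)

∧-linked-pairPoint-or : ∀ {n} (φ ψ : Formula n) → ReadOnceTree (or′ φ ψ) → ∀ {i j ci cj} →
  occurs (or′ φ ψ) i ≡ true → occurs (or′ φ ψ) j ≡ true → i ≢ j → MaxFalse (or′ φ ψ) i ci → MaxFalse (or′ φ ψ) j cj →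
  ∧-linked (or′ φ ψ) i j ≡ cj i ∧ ci j ∧ eval (or′ φ ψ) (pairPoint ci cj i j)

∧-linked-pairPoint (var x) _ φi φj i≢j _ _ = ⊥-elim (i≢j (trans (==⇒≡ φi) (sym (==⇒≡ φj))))
∧-linked-pairPoint (and′ φ ψ) = ∧-linked-pairPoint-and φ ψ
∧-linked-pairPoint (or′ φ ψ)  = ∧-linked-pairPoint-or φ ψ

∧-linked-pairPoint-and φ ψ (roφ , roψ , φ#ψ) {i} {j} {ci} {cj} i∈ j∈ i≢j Mi Mj
  with true-or-false (occurs φ i) | true-or-false (occurs φ j)
... | inj₁ φi | inj₁ φj =
  trans (∧-linked-and-withinˡ φ ψ φ#ψ φi φj)
    (trans (∧-linked-pairPoint φ roφ φi φj i≢j (proj₁ (MaxFalse-andˡ φ ψ φ#ψ φi Mi)) (proj₁ (MaxFalse-andˡ φ ψ φ#ψ φj Mj)))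
           (cong (λ x → cj i ∧ ci j ∧ x) (sym (∧-trueʳ _ ψW))))
  where
  ψW = pairPoint-all-on ci cj i j ψ (MaxFalse-and-onʳ φ ψ φ#ψ φi Mi) (MaxFalse-and-onʳ φ ψ φ#ψ φj Mj)
... | inj₂ ¬φi | inj₂ ¬φj =
  trans (∧-linked-and-withinʳ φ ψ φ#ψ ψi ψj)
    (trans (∧-linked-pairPoint ψ roψ ψi ψj i≢j (proj₁ (MaxFalse-andʳ φ ψ φ#ψ ψi Mi)) (proj₁ (MaxFalse-andʳ φ ψ φ#ψ ψj Mj)))
           (cong (λ x → cj i ∧ ci j ∧ (x ∧ eval ψ (pairPoint ci cj i j))) (sym φW)))
  where
  ψi = notLeft⇒right φ ψ i∈ ¬φi
  ψj = notLeft⇒right φ ψ j∈ ¬φj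
  φW = pairPoint-all-on ci cj i j φ (MaxFalse-and-onˡ φ ψ φ#ψ ψi Mi) (MaxFalse-and-onˡ φ ψ φ#ψ ψj Mj)
... | inj₁ φi | inj₂ ¬φj =
  trans (∧-linked-acrossˡ φ ψ φ#ψ φi ψj) (sym (cong₂ _∧_ cji (cong₂ _∧_ cij (cong₂ _∧_ φW ψW))))
  where
  ψj = notLeft⇒right φ ψ j∈ ¬φj
  cji = MaxFalse-and-onˡ φ ψ φ#ψ ψj Mj i φi
  cij = MaxFalse-and-onʳ φ ψ φ#ψ φi Mi j ψj
  φW = pairPoint-raisesˡ ci cj i j φ ¬φj (MaxFalse-and-onˡ φ ψ φ#ψ ψj Mj) (proj₁ (MaxFalse-andˡ φ ψ φ#ψ φi Mi)) φi
  ψW = pairPoint-raisesʳ ci cj i j ψ (φ#ψ i φi) (MaxFalse-and-onʳ φ ψ φ#ψ φi Mi) (proj₁ (MaxFalse-andʳ φ ψ φ#ψ ψj Mj)) ψj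
... | inj₂ ¬φi | inj₁ φj =
  trans (∧-linked-acrossʳ φ ψ φ#ψ ψi φj) (sym (cong₂ _∧_ cji (cong₂ _∧_ cij (cong₂ _∧_ φW ψW))))
  where
  ψi = notLeft⇒right φ ψ i∈ ¬φi
  cji = MaxFalse-and-onʳ φ ψ φ#ψ φj Mj i ψi
  cij = MaxFalse-and-onˡ φ ψ φ#ψ ψi Mi j φj
  φW = pairPoint-raisesʳ ci cj i j φ ¬φi (MaxFalse-and-onˡ φ ψ φ#ψ ψi Mi) (proj₁ (MaxFalse-andˡ φ ψ φ#ψ φj Mj)) φj
  ψW = pairPoint-raisesˡ ci cj i j ψ (φ#ψ j φj) (MaxFalse-and-onʳ φ ψ φ#ψ φj Mj) (proj₁ (MaxFalse-andʳ φ ψ φ#ψ ψi Mi)) ψi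

∧-linked-pairPoint-or φ ψ (roφ , roψ , φ#ψ) {i} {j} {ci} {cj} i∈ j∈ i≢j Mi Mj
  with true-or-false (occurs φ i) | true-or-false (occurs φ j)
... | inj₁ φi | inj₁ φj =
  trans (∧-linked-orˡ φ ψ φ#ψ φi)
    (trans (∧-linked-pairPoint φ roφ φi φj i≢j (proj₁ (MaxFalse-orˡ φ ψ φ#ψ φi Mi)) (proj₁ (MaxFalse-orˡ φ ψ φ#ψ φj Mj)))
           (cong (λ x → cj i ∧ ci j ∧ x) (sym (∨-falseʳ _ ψW))))
  where
  ψW = pairPoint-rejects-both ci cj i j ψ (φ#ψ i φi) (φ#ψ j φj) (proj₂ (MaxFalse-orˡ φ ψ φ#ψ φi Mi))
... | inj₂ ¬φi | inj₂ ¬φj =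
  trans (∧-linked-orʳ φ ψ φ#ψ ψi)
    (trans (∧-linked-pairPoint ψ roψ ψi ψj i≢j (proj₁ (MaxFalse-orʳ φ ψ φ#ψ ψi Mi)) (proj₁ (MaxFalse-orʳ φ ψ φ#ψ ψj Mj)))
           (cong (λ x → cj i ∧ ci j ∧ (x ∨ eval ψ (pairPoint ci cj i j))) (sym φW)))
  where
  ψi = notLeft⇒right φ ψ i∈ ¬φi
  ψj = notLeft⇒right φ ψ j∈ ¬φj
  φW = pairPoint-rejects-both ci cj i j φ ¬φi ¬φj (proj₂ (MaxFalse-orʳ φ ψ φ#ψ ψi Mi))
... | inj₁ φi | inj₂ ¬φj =
  trans (trans (∧-linked-orˡ φ ψ φ#ψ φi) (∧-linked-absentʳ φ ¬φj)) (sym rhs)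
  where
  ψj = notLeft⇒right φ ψ j∈ ¬φj
  rhs : cj i ∧ ci j ∧ eval (or′ φ ψ) (pairPoint ci cj i j) ≡ false
  rhs with cj i in cji | ci j in cij
  ... | false | _     = refl
  ... | true  | false = refl
  ... | true  | true  rewrite pairPoint-rejectsʳ ci cj i j φ cji ¬φj (proj₂ (MaxFalse-orʳ φ ψ φ#ψ ψj Mj))
                            | pairPoint-rejectsˡ ci cj i j ψ cij (φ#ψ i φi) (proj₂ (MaxFalse-orˡ φ ψ φ#ψ φi Mi)) = refl
... | inj₂ ¬φi | inj₁ φj =
  trans (trans (∧-linked-orʳ φ ψ φ#ψ ψi) (∧-linked-absentʳ ψ (φ#ψ j φj))) (sym rhs)
  where
  ψi = notLeft⇒right φ ψ i∈ ¬φi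
  rhs : cj i ∧ ci j ∧ eval (or′ φ ψ) (pairPoint ci cj i j) ≡ false
  rhs with cj i in cji | ci j in cij
  ... | false | _     = refl
  ... | true  | false = refl
  ... | true  | true  rewrite pairPoint-rejectsˡ ci cj i j φ cij ¬φi (proj₂ (MaxFalse-orʳ φ ψ φ#ψ ψi Mi))
                            | pairPoint-rejectsʳ ci cj i j ψ cji (φ#ψ j φj) (proj₂ (MaxFalse-orˡ φ ψ φ#ψ φj Mj)) = refl

record Explored {n} (φ : Formula n) (D : Fin n → Bool) (k : Fin n) : Set where
  constructor explored
  field
    low         : Assignment n
    high        : Assignment n
    low-max     : MaxFalse φ k low
    high-min    : MinTrue φ k high
    zeros-found : ∀ m → occurs φ m ≡ true → low m ≡ false → D m ≡ true
    ones-found  : ∀ m → occurs φ m ≡ true → high m ≡ true → D m ≡ true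

open Explored

Closed : ∀ {n} → Formula n → (Fin n → Bool) → Set
Closed φ D = ∀ k → occurs φ k ≡ true → D k ≡ true → Explored φ D k

Meets : ∀ {n} → Formula n → (Fin n → Bool) → Set
Meets {n} χ D = Σ (Fin n) λ m → occurs χ m ≡ true × D m ≡ true

module _ {n} (θ χ : Formula n) {D : Fin n → Bool} (χ⊆θ : ∀ {m} → occurs χ m ≡ true → occurs θ m ≡ true) where

  Closed-restrict : (∀ {k c} → occurs χ k ≡ true → MaxFalse θ k c → MaxFalse χ k c) →
                    (∀ {k d} → occurs χ k ≡ true → MinTrue θ k d → MinTrue χ k d) →
                    Closed θ D → Closed χ D
  Closed-restrict max↓ min↓ closed k χk Dk with closed k (χ⊆θ χk) Dk
  ... | explored c d M N zeros ones =
    explored c d (max↓ χk M) (min↓ χk N) (λ m χm → zeros m (χ⊆θ χm)) (λ m χm → ones m (χ⊆θ χm))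

  meets-via-low : ∀ {k} (E : Explored θ D k) → eval χ (low E) ≡ false → Meets χ D
  meets-via-low E χc with false-witness χ χc
  ... | m , χm , cm = m , χm , zeros-found E m (χ⊆θ χm) cm

  meets-via-high : ∀ {k} (E : Explored θ D k) → eval χ (high E) ≡ true → Meets χ D
  meets-via-high E χd with true-witness χ χd
  ... | m , χm , dm = m , χm , ones-found E m (χ⊆θ χm) dm

module _ {n} (φ ψ : Formula n) (φ#ψ : Disjoint φ ψ) {D : Fin n → Bool} where

  Closed-andˡ : Closed (and′ φ ψ) D → Closed φ D
  Closed-andˡ = Closed-restrict (and′ φ ψ) φ (inLeft φ ψ) (λ φk → proj₁ ∘ MaxFalse-andˡ φ ψ φ#ψ φk) (λ φk → proj₁ ∘ MinTrue-andˡ φ ψ φ#ψ φk)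

  Closed-andʳ : Closed (and′ φ ψ) D → Closed ψ D
  Closed-andʳ = Closed-restrict (and′ φ ψ) ψ (inRight φ ψ) (λ ψk → proj₁ ∘ MaxFalse-andʳ φ ψ φ#ψ ψk) (λ ψk → proj₁ ∘ MinTrue-andʳ φ ψ φ#ψ ψk)

  Closed-orˡ : Closed (or′ φ ψ) D → Closed φ D
  Closed-orˡ = Closed-restrict (or′ φ ψ) φ (inLeft φ ψ) (λ φk → proj₁ ∘ MaxFalse-orˡ φ ψ φ#ψ φk) (λ φk → proj₁ ∘ MinTrue-orˡ φ ψ φ#ψ φk)

  Closed-orʳ : Closed (or′ φ ψ) D → Closed ψ D
  Closed-orʳ = Closed-restrict (or′ φ ψ) ψ (inRight φ ψ) (λ ψk → proj₁ ∘ MaxFalse-orʳ φ ψ φ#ψ ψk) (λ ψk → proj₁ ∘ MinTrue-orʳ φ ψ φ#ψ ψk)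

  -- A minimal true point for a variable of one side of an ∧ satisfies the other side;
  -- a maximal false point for a variable of one side of an ∨ falsifies the other side.
  Closed-and-meets : Closed (and′ φ ψ) D → Meets (and′ φ ψ) D → Meets φ D × Meets ψ D
  Closed-and-meets closed (k , k∈ , Dk) with true-or-false (occurs φ k)
  ... | inj₁ φk = (k , φk , Dk) , meets-via-high (and′ φ ψ) ψ (inRight φ ψ) E (proj₂ (MinTrue-andˡ φ ψ φ#ψ φk (high-min E)))
    where E = closed k k∈ Dk
  ... | inj₂ ¬φk = meets-via-high (and′ φ ψ) φ (inLeft φ ψ) E (proj₂ (MinTrue-andʳ φ ψ φ#ψ ψk (high-min E))) , (k , ψk , Dk)
    where
    ψk = notLeft⇒right φ ψ k∈ ¬φk
    E = closed k k∈ Dk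

  Closed-or-meets : Closed (or′ φ ψ) D → Meets (or′ φ ψ) D → Meets φ D × Meets ψ D
  Closed-or-meets closed (k , k∈ , Dk) with true-or-false (occurs φ k)
  ... | inj₁ φk = (k , φk , Dk) , meets-via-low (or′ φ ψ) ψ (inRight φ ψ) E (proj₂ (MaxFalse-orˡ φ ψ φ#ψ φk (low-max E)))
    where E = closed k k∈ Dk
  ... | inj₂ ¬φk = meets-via-low (or′ φ ψ) φ (inLeft φ ψ) E (proj₂ (MaxFalse-orʳ φ ψ φ#ψ ψk (low-max E))) , (k , ψk , Dk)
    where
    ψk = notLeft⇒right φ ψ k∈ ¬φk
    E = closed k k∈ Dk

on-both-sides : ∀ {n} (φ ψ : Formula n) {D : Fin n → Bool} →
  (∀ m → occurs φ m ≡ true → D m ≡ true) → (∀ m → occurs ψ m ≡ true → D m ≡ true) →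
  ∀ m → occurs φ m ∨ occurs ψ m ≡ true → D m ≡ true
on-both-sides φ ψ onφ onψ m e with ∨≡true⇒ {occurs φ m} e
... | inj₁ φm = onφ m φm
... | inj₂ ψm = onψ m ψm

Closed-complete : ∀ {n} (φ : Formula n) → ReadOnceTree φ → ∀ {D} → Closed φ D → Meets φ D →
                  ∀ m → occurs φ m ≡ true → D m ≡ true
Closed-complete (var x) _ {D} _ (k , φk , Dk) m φm = subst (λ z → D z ≡ true) (trans (==⇒≡ φk) (sym (==⇒≡ φm))) Dk
Closed-complete (and′ φ ψ) (roφ , roψ , φ#ψ) closed meets with Closed-and-meets φ ψ φ#ψ closed meets
... | meetsφ , meetsψ = on-both-sides φ ψ (Closed-complete φ roφ (Closed-andˡ φ ψ φ#ψ closed) meetsφ)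
                                          (Closed-complete ψ roψ (Closed-andʳ φ ψ φ#ψ closed) meetsψ)
Closed-complete (or′ φ ψ) (roφ , roψ , φ#ψ) closed meets with Closed-or-meets φ ψ φ#ψ closed meets
... | meetsφ , meetsψ = on-both-sides φ ψ (Closed-complete φ roφ (Closed-orˡ φ ψ φ#ψ closed) meetsφ)
                                          (Closed-complete ψ roψ (Closed-orʳ φ ψ φ#ψ closed) meetsψ)

-- Evaluating a read-once formula from its variables and ∧-relation

record Certificate {n} (occ : Fin n → Bool) (link : Fin n → Fin n → Bool) (a : Assignment n) (S : Fin n → Bool) : Set where
  constructor certificate
  field
    chosen   : ∀ s → S s ≡ true → occ s ≡ true × a s ≡ true
    nonempty : Σ (Fin n) λ s → S s ≡ true
    linked   : ∀ s t → S s ≡ true → S t ≡ true → s ≢ t → link s t ≡ true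
    blocked  : ∀ v → occ v ≡ true → a v ≡ false → Σ (Fin n) λ s → S s ≡ true × link v s ≡ false

open Certificate

FormulaCertificate : ∀ {n} → Formula n → Assignment n → (Fin n → Bool) → Set
FormulaCertificate φ = Certificate (occurs φ) (∧-linked φ)

Certificate-var : ∀ {n} {x : Fin n} {a} → a x ≡ true → FormulaCertificate (var x) a (_== x)
Certificate-var {x = x} {a} ax = certificate
  (λ s s≡x → s≡x , subst (λ z → a z ≡ true) (sym (==⇒≡ s≡x)) ax)
  (x , ==-refl x)
  (λ s t s≡x t≡x s≢t → ⊥-elim (s≢t (trans (==⇒≡ s≡x) (sym (==⇒≡ t≡x)))))
  (λ v v≡x av → ⊥-elim (true≢false (trans (sym ax) (subst (λ z → a z ≡ false) (==⇒≡ v≡x) av))))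

module _ {n} (φ ψ : Formula n) (φ#ψ : Disjoint φ ψ) {a : Assignment n} where

  private
    ψ#φ = Disjoint-sym φ ψ φ#ψ

  Certificate-and : ∀ {S₁ S₂} → FormulaCertificate φ a S₁ → FormulaCertificate ψ a S₂ →
                    FormulaCertificate (and′ φ ψ) a (λ s → S₁ s ∨ S₂ s)
  Certificate-and {S₁} {S₂} C₁ C₂ = certificate chosen′ (s₁ , ∨-introˡ S₁s₁) linked′ blocked′
    where
    s₁ = proj₁ (nonempty C₁)
    S₁s₁ = proj₂ (nonempty C₁)
    chosen′ : ∀ s → S₁ s ∨ S₂ s ≡ true → occurs (and′ φ ψ) s ≡ true × a s ≡ true
    chosen′ s p with ∨≡true⇒ {S₁ s} p
    ... | inj₁ x = inLeft φ ψ (proj₁ (chosen C₁ s x)) , proj₂ (chosen C₁ s x)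
    ... | inj₂ y = inRight φ ψ (proj₁ (chosen C₂ s y)) , proj₂ (chosen C₂ s y)
    linked′ : ∀ s t → S₁ s ∨ S₂ s ≡ true → S₁ t ∨ S₂ t ≡ true → s ≢ t → ∧-linked (and′ φ ψ) s t ≡ true
    linked′ s t p q s≢t with ∨≡true⇒ {S₁ s} p | ∨≡true⇒ {S₁ t} q
    ... | inj₁ x | inj₁ y = trans (∧-linked-and-withinˡ φ ψ φ#ψ (proj₁ (chosen C₁ s x)) (proj₁ (chosen C₁ t y)))
                                  (linked C₁ s t x y s≢t)
    ... | inj₁ x | inj₂ y = ∧-linked-acrossˡ φ ψ φ#ψ (proj₁ (chosen C₁ s x)) (proj₁ (chosen C₂ t y))
    ... | inj₂ x | inj₁ y = ∧-linked-acrossʳ φ ψ φ#ψ (proj₁ (chosen C₂ s x)) (proj₁ (chosen C₁ t y))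
    ... | inj₂ x | inj₂ y = trans (∧-linked-and-withinʳ φ ψ φ#ψ (proj₁ (chosen C₂ s x)) (proj₁ (chosen C₂ t y)))
                                  (linked C₂ s t x y s≢t)
    blocked′ : ∀ v → occurs (and′ φ ψ) v ≡ true → a v ≡ false →
               Σ (Fin n) λ s → S₁ s ∨ S₂ s ≡ true × ∧-linked (and′ φ ψ) v s ≡ false
    blocked′ v v∈ av with true-or-false (occurs φ v)
    ... | inj₁ φv with blocked C₁ v φv av
    ...   | s , S₁s , ¬l = s , ∨-introˡ S₁s , trans (∧-linked-and-withinˡ φ ψ φ#ψ φv (proj₁ (chosen C₁ s S₁s))) ¬l
    blocked′ v v∈ av | inj₂ ¬φv with blocked C₂ v (notLeft⇒right φ ψ v∈ ¬φv) av
    ...   | s , S₂s , ¬l = s , ∨-introʳ {S₁ s} S₂s ,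
                           trans (∧-linked-and-withinʳ φ ψ φ#ψ (notLeft⇒right φ ψ v∈ ¬φv) (proj₁ (chosen C₂ s S₂s))) ¬l

  Certificate-orˡ : ∀ {S} → FormulaCertificate φ a S → FormulaCertificate (or′ φ ψ) a S
  Certificate-orˡ {S} C = certificate
    (λ s Ss → inLeft φ ψ (proj₁ (chosen C s Ss)) , proj₂ (chosen C s Ss))
    (nonempty C)
    (λ s t Ss St s≢t → trans (∧-linked-orˡ φ ψ φ#ψ (proj₁ (chosen C s Ss))) (linked C s t Ss St s≢t))
    blocked′
    where
    blocked′ : ∀ v → occurs (or′ φ ψ) v ≡ true → a v ≡ false → Σ (Fin n) λ s → S s ≡ true × ∧-linked (or′ φ ψ) v s ≡ false
    blocked′ v v∈ av with true-or-false (occurs φ v)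
    ... | inj₁ φv with blocked C v φv av
    ...   | s , Ss , ¬l = s , Ss , trans (∧-linked-orˡ φ ψ φ#ψ φv) ¬l
    blocked′ v v∈ av | inj₂ ¬φv with nonempty C
    ...   | s , Ss = s , Ss , trans (∧-linked-orʳ φ ψ φ#ψ (notLeft⇒right φ ψ v∈ ¬φv))
                                    (∧-linked-absentʳ ψ (φ#ψ s (proj₁ (chosen C s Ss))))

  Certificate-orʳ : ∀ {S} → FormulaCertificate ψ a S → FormulaCertificate (or′ φ ψ) a S
  Certificate-orʳ {S} C = certificate
    (λ s Ss → inRight φ ψ (proj₁ (chosen C s Ss)) , proj₂ (chosen C s Ss))
    (nonempty C)
    (λ s t Ss St s≢t → trans (∧-linked-orʳ φ ψ φ#ψ (proj₁ (chosen C s Ss))) (linked C s t Ss St s≢t))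
    blocked′
    where
    blocked′ : ∀ v → occurs (or′ φ ψ) v ≡ true → a v ≡ false → Σ (Fin n) λ s → S s ≡ true × ∧-linked (or′ φ ψ) v s ≡ false
    blocked′ v v∈ av with true-or-false (occurs ψ v)
    ... | inj₁ ψv with blocked C v ψv av
    ...   | s , Ss , ¬l = s , Ss , trans (∧-linked-orʳ φ ψ φ#ψ ψv) ¬l
    blocked′ v v∈ av | inj₂ ¬ψv with nonempty C
    ...   | s , Ss = s , Ss , trans (∧-linked-orˡ φ ψ φ#ψ (notRight⇒left φ ψ v∈ ¬ψv))
                                    (∧-linked-absentʳ φ (ψ#φ s (proj₁ (chosen C s Ss))))

certificate-of-true : ∀ {n} (φ : Formula n) → ReadOnceTree φ → ∀ {a} → eval φ a ≡ true →
                      Σ (Fin n → Bool) (FormulaCertificate φ a)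
certificate-of-true (var x) _ ax = (_== x) , Certificate-var ax
certificate-of-true (and′ φ ψ) (roφ , roψ , φ#ψ) {a} e
  with certificate-of-true φ roφ (proj₁ (∧≡true⇒ e)) | certificate-of-true ψ roψ (proj₂ (∧≡true⇒ {eval φ a} e))
... | S₁ , C₁ | S₂ , C₂ = (λ s → S₁ s ∨ S₂ s) , Certificate-and φ ψ φ#ψ C₁ C₂
certificate-of-true (or′ φ ψ) (roφ , roψ , φ#ψ) {a} e with ∨≡true⇒ {eval φ a} e
... | inj₁ φa = let (S , C) = certificate-of-true φ roφ φa in S , Certificate-orˡ φ ψ φ#ψ C
... | inj₂ ψa = let (S , C) = certificate-of-true ψ roψ ψa in S , Certificate-orʳ φ ψ φ#ψ C

module _ {n} (φ ψ : Formula n) (φ#ψ : Disjoint φ ψ) {a : Assignment n} {S : Fin n → Bool}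
         (C : FormulaCertificate (and′ φ ψ) a S) where

  private
    ψ#φ = Disjoint-sym φ ψ φ#ψ

  blocker-sideˡ : ∀ {v s} → occurs φ v ≡ true → S s ≡ true → ∧-linked (and′ φ ψ) v s ≡ false → occurs φ s ≡ true
  blocker-sideˡ {v} {s} φv Ss ¬l with true-or-false (occurs ψ s)
  ... | inj₁ ψs = ⊥-elim (true≢false (trans (sym (∧-linked-acrossˡ φ ψ φ#ψ φv ψs)) ¬l))
  ... | inj₂ ¬ψs = notRight⇒left φ ψ (proj₁ (chosen C s Ss)) ¬ψs

  blocker-sideʳ : ∀ {v s} → occurs ψ v ≡ true → S s ≡ true → ∧-linked (and′ φ ψ) v s ≡ false → occurs ψ s ≡ true
  blocker-sideʳ {v} {s} ψv Ss ¬l with true-or-false (occurs φ s)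
  ... | inj₁ φs = ⊥-elim (true≢false (trans (sym (∧-linked-acrossʳ φ ψ φ#ψ ψv φs)) ¬l))
  ... | inj₂ ¬φs = notLeft⇒right φ ψ (proj₁ (chosen C s Ss)) ¬φs

  Certificate-and⁻ˡ : ∀ {s} → S s ≡ true → occurs φ s ≡ true → FormulaCertificate φ a (λ s → S s ∧ occurs φ s)
  Certificate-and⁻ˡ {s₀} Ss₀ φs₀ = certificate
    (λ s p → proj₂ (∧≡true⇒ {S s} p) , proj₂ (chosen C s (proj₁ (∧≡true⇒ p))))
    (s₀ , cong₂ _∧_ Ss₀ φs₀)
    (λ s t p q s≢t → let (Ss , φs) = ∧≡true⇒ {S s} p ; (St , φt) = ∧≡true⇒ {S t} q in
                     trans (sym (∧-linked-and-withinˡ φ ψ φ#ψ φs φt)) (linked C s t Ss St s≢t))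
    blocked′
    where
    blocked′ : ∀ v → occurs φ v ≡ true → a v ≡ false → Σ (Fin n) λ s → S s ∧ occurs φ s ≡ true × ∧-linked φ v s ≡ false
    blocked′ v φv av with blocked C v (inLeft φ ψ φv) av
    ... | s , Ss , ¬l = s , cong₂ _∧_ Ss φs , trans (sym (∧-linked-and-withinˡ φ ψ φ#ψ φv φs)) ¬l
      where φs = blocker-sideˡ φv Ss ¬l

  Certificate-and⁻ʳ : ∀ {s} → S s ≡ true → occurs ψ s ≡ true → FormulaCertificate ψ a (λ s → S s ∧ occurs ψ s)
  Certificate-and⁻ʳ {s₀} Ss₀ ψs₀ = certificate
    (λ s p → proj₂ (∧≡true⇒ {S s} p) , proj₂ (chosen C s (proj₁ (∧≡true⇒ p))))
    (s₀ , cong₂ _∧_ Ss₀ ψs₀)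
    (λ s t p q s≢t → let (Ss , ψs) = ∧≡true⇒ {S s} p ; (St , ψt) = ∧≡true⇒ {S t} q in
                     trans (sym (∧-linked-and-withinʳ φ ψ φ#ψ ψs ψt)) (linked C s t Ss St s≢t))
    blocked′
    where
    blocked′ : ∀ v → occurs ψ v ≡ true → a v ≡ false → Σ (Fin n) λ s → S s ∧ occurs ψ s ≡ true × ∧-linked ψ v s ≡ false
    blocked′ v ψv av with blocked C v (inRight φ ψ ψv) av
    ... | s , Ss , ¬l = s , cong₂ _∧_ Ss ψs , trans (sym (∧-linked-and-withinʳ φ ψ φ#ψ ψv ψs)) ¬l
      where ψs = blocker-sideʳ ψv Ss ¬l

module _ {n} (φ ψ : Formula n) (φ#ψ : Disjoint φ ψ) {a : Assignment n} {S : Fin n → Bool}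
         (C : FormulaCertificate (or′ φ ψ) a S) where

  -- Members of S are pairwise ∧-linked, and no ∧-link crosses an ∨-node.
  Certificate-or⁻ˡ : ∀ {s₀} → S s₀ ≡ true → occurs φ s₀ ≡ true → FormulaCertificate φ a S
  Certificate-or⁻ˡ {s₀} Ss₀ φs₀ = certificate
    (λ s Ss → inφ s Ss , proj₂ (chosen C s Ss))
    (s₀ , Ss₀)
    (λ s t Ss St s≢t → trans (sym (∧-linked-orˡ φ ψ φ#ψ (inφ s Ss))) (linked C s t Ss St s≢t))
    blocked′
    where
    inφ : ∀ t → S t ≡ true → occurs φ t ≡ true
    inφ t St with t ≟ s₀
    ... | yes refl = φs₀
    ... | no t≢s₀  = proj₂ (∧-linked⇒occurs φ (trans (sym (∧-linked-orˡ φ ψ φ#ψ φs₀)) (linked C s₀ t Ss₀ St (t≢s₀ ∘ sym))))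
    blocked′ : ∀ v → occurs φ v ≡ true → a v ≡ false → Σ (Fin n) λ s → S s ≡ true × ∧-linked φ v s ≡ false
    blocked′ v φv av with blocked C v (inLeft φ ψ φv) av
    ... | s , Ss , ¬l = s , Ss , trans (sym (∧-linked-orˡ φ ψ φ#ψ φv)) ¬l

  Certificate-or⁻ʳ : ∀ {s₀} → S s₀ ≡ true → occurs ψ s₀ ≡ true → FormulaCertificate ψ a S
  Certificate-or⁻ʳ {s₀} Ss₀ ψs₀ = certificate
    (λ s Ss → inψ s Ss , proj₂ (chosen C s Ss))
    (s₀ , Ss₀)
    (λ s t Ss St s≢t → trans (sym (∧-linked-orʳ φ ψ φ#ψ (inψ s Ss))) (linked C s t Ss St s≢t))
    blocked′
    where
    inψ : ∀ t → S t ≡ true → occurs ψ t ≡ true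
    inψ t St with t ≟ s₀
    ... | yes refl = ψs₀
    ... | no t≢s₀  = proj₂ (∧-linked⇒occurs ψ (trans (sym (∧-linked-orʳ φ ψ φ#ψ ψs₀)) (linked C s₀ t Ss₀ St (t≢s₀ ∘ sym))))
    blocked′ : ∀ v → occurs ψ v ≡ true → a v ≡ false → Σ (Fin n) λ s → S s ≡ true × ∧-linked ψ v s ≡ false
    blocked′ v ψv av with blocked C v (inRight φ ψ ψv) av
    ... | s , Ss , ¬l = s , Ss , trans (sym (∧-linked-orʳ φ ψ φ#ψ ψv)) ¬l

true-of-certificate : ∀ {n} (φ : Formula n) → ReadOnceTree φ → ∀ {a S} → FormulaCertificate φ a S → eval φ a ≡ true
true-of-certificate (var x) _ {a} C with nonempty C
... | s , Ss = subst (λ z → a z ≡ true) (==⇒≡ (proj₁ (chosen C s Ss))) (proj₂ (chosen C s Ss))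
true-of-certificate (and′ φ ψ) (roφ , roψ , φ#ψ) {a} C = cong₂ _∧_ φa ψa
  where
  φa : eval φ a ≡ true
  φa = true-unless-false λ ¬φa →
    let (v , φv , av) = false-witness φ ¬φa ; (s , Ss , ¬l) = blocked C v (inLeft φ ψ φv) av in
    true-of-certificate φ roφ (Certificate-and⁻ˡ φ ψ φ#ψ C Ss (blocker-sideˡ φ ψ φ#ψ C φv Ss ¬l))
  ψa : eval ψ a ≡ true
  ψa = true-unless-false λ ¬ψa →
    let (v , ψv , av) = false-witness ψ ¬ψa ; (s , Ss , ¬l) = blocked C v (inRight φ ψ ψv) av in
    true-of-certificate ψ roψ (Certificate-and⁻ʳ φ ψ φ#ψ C Ss (blocker-sideʳ φ ψ φ#ψ C ψv Ss ¬l))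
true-of-certificate (or′ φ ψ) (roφ , roψ , φ#ψ) C with nonempty C
... | s , Ss with true-or-false (occurs φ s)
...   | inj₁ φs  = ∨-introˡ (true-of-certificate φ roφ (Certificate-or⁻ˡ φ ψ φ#ψ C Ss φs))
...   | inj₂ ¬φs = ∨-introʳ (true-of-certificate ψ roψ (Certificate-or⁻ʳ φ ψ φ#ψ C Ss (notLeft⇒right φ ψ (proj₁ (chosen C s Ss)) ¬φs)))

-- Membership-query programs and their simulation by subcube queries

data MQ (n : ℕ) (A : Set) : Set where
  pure  : A → MQ n A
  query : Assignment n → (Bool → MQ n A) → MQ n A

module _ {n : ℕ} where

  infixl 1 _>>=_
  _>>=_ : ∀ {A B} → MQ n A → (A → MQ n B) → MQ n B
  pure x    >>= k = k x
  query a g >>= k = query a (λ b → g b >>= k)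

  result : ∀ {A} → BoolFun n → MQ n A → A
  result f (pure x)    = x
  result f (query a g) = result f (g (f a))

  cost : ∀ {A} → BoolFun n → MQ n A → ℕ
  cost f (pure x)    = 0
  cost f (query a g) = suc (cost f (g (f a)))

  result->>= : ∀ {A B} f (p : MQ n A) (k : A → MQ n B) → result f (p >>= k) ≡ result f (k (result f p))
  result->>= f (pure x)    k = refl
  result->>= f (query a g) k = result->>= f (g (f a)) k

  cost->>= : ∀ {A B} f (p : MQ n A) (k : A → MQ n B) → cost f (p >>= k) ≡ cost f p + cost f (k (result f p))
  cost->>= f (pure x)    k = refl
  cost->>= f (query a g) k = cong suc (cost->>= f (g (f a)) k)

  result-cong : ∀ {A} {f g : BoolFun n} → (∀ a → f a ≡ g a) → (p : MQ n A) → result f p ≡ result g p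
  result-cong f≗g (pure x)                  = refl
  result-cong {g = g} f≗g (query a h) rewrite f≗g a = result-cong f≗g (h (g a))

  below : Assignment n → PartialAssignment n
  below a k = if a k then nothing else just false

  below-⊕ : ∀ a b m → (below a ⊕ b) m ≡ a m ∧ b m
  below-⊕ a b m with a m
  ... | true  = refl
  ... | false = refl

  below-answer : ∀ {f : BoolFun n} → Monotone f → f (λ _ → false) ≡ false →
                 ∀ a → CorrectAnswer f (below a) (not (f a))
  below-answer {f} mono f0 a = yes⇒constant , constant⇒yes
    where
    below-a : ∀ b → (below a ⊕ b) ≤ₐ a
    below-a b m p = proj₁ (∧≡true⇒ (trans (sym (below-⊕ a b m)) p))
    yes⇒constant : not (f a) ≡ true → ProjectionConstant f (below a)
    yes⇒constant e = inj₁ λ b → antimono mono (below-a b) (trans (sym (not-involutive (f a))) (cong not e))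
    constant⇒yes : ProjectionConstant f (below a) → not (f a) ≡ true
    constant⇒yes (inj₁ all0) = cong not (antimono mono (λ m am → trans (below-⊕ a (λ _ → true) m) (cong (_∧ true) am)) (all0 (λ _ → true)))
    constant⇒yes (inj₂ all1) = ⊥-elim (true≢false (trans (sym (all1 (λ _ → false)))
                                 (antimono mono (λ m p → ⊥-elim (true≢false (trans (sym p) (trans (below-⊕ a _ m) (∧-zeroʳ (a m)))))) f0)))

  toAlgorithm : MQ n (BoolFun n) → Algorithm n
  toAlgorithm (pure h)    = output h
  toAlgorithm (query a g) = ask (below a) (λ b → toAlgorithm (g (not b)))

  toAlgorithm-runs : ∀ f → (∀ a → CorrectAnswer f (below a) (not (f a))) → (P : MQ n (BoolFun n)) →
                     Runs (toAlgorithm P) f (cost f P) (result f P)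
  toAlgorithm-runs f answers (pure h)    = done
  toAlgorithm-runs f answers (query a g) =
    step (answers a) (subst (λ x → Runs (toAlgorithm (g x)) f (cost f (g (f a))) (result f (g (f a))))
                            (sym (not-involutive (f a))) (toAlgorithm-runs f answers (g (f a))))

raise-greedy : ∀ {n} → (Fin n → Bool) → List (Fin n) → Assignment n → MQ n (Assignment n)
raise-greedy prot []       c = pure c
raise-greedy prot (m ∷ ms) c = query (update c m true) λ b →
  raise-greedy prot ms (if not (prot m) ∧ not (c m) ∧ not b then update c m true else c)

lower-greedy : ∀ {n} → (Fin n → Bool) → List (Fin n) → Assignment n → MQ n (Assignment n)
lower-greedy prot []       d = pure d
lower-greedy prot (m ∷ ms) d = query (update d m false) λ b →
  lower-greedy prot ms (if not (prot m) ∧ d m ∧ b then update d m false else d)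

raise-greedy-cost : ∀ {n} f prot ms (c : Assignment n) → cost f (raise-greedy prot ms c) ≡ length ms
raise-greedy-cost f prot []       c = refl
raise-greedy-cost f prot (m ∷ ms) c = cong suc (raise-greedy-cost f prot ms _)

lower-greedy-cost : ∀ {n} f prot ms (d : Assignment n) → cost f (lower-greedy prot ms d) ≡ length ms
lower-greedy-cost f prot []       d = refl
lower-greedy-cost f prot (m ∷ ms) d = cong suc (lower-greedy-cost f prot ms _)

module Greedy {n : ℕ} (F : BoolFun n) (mono : Monotone F) where

  raise-greedy-≥ : ∀ prot ms c → c ≤ₐ result F (raise-greedy prot ms c)
  raise-greedy-≥ prot []       c m p = p
  raise-greedy-≥ prot (x ∷ ms) c m p with not (prot x) ∧ not (c x) ∧ not (F (update c x true))
  ... | true  = raise-greedy-≥ prot ms (update c x true) m (≤ₐ-update-true c x m p)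
  ... | false = raise-greedy-≥ prot ms c m p

  raise-greedy-protected : ∀ prot ms c m → prot m ≡ true → result F (raise-greedy prot ms c) m ≡ c m
  raise-greedy-protected prot []       c m pm = refl
  raise-greedy-protected prot (x ∷ ms) c m pm with prot x in px | c x | F (update c x true)
  ... | true  | _     | _     = raise-greedy-protected prot ms c m pm
  ... | false | true  | _     = raise-greedy-protected prot ms c m pm
  ... | false | false | true  = raise-greedy-protected prot ms c m pm
  ... | false | false | false = trans (raise-greedy-protected prot ms (update c x true) m pm)
                                      (update-other c true λ { refl → true≢false (trans (sym pm) px) })

  raise-greedy-rejects : ∀ prot ms c → F c ≡ false → F (result F (raise-greedy prot ms c)) ≡ false
  raise-greedy-rejects prot []       c Fc = Fc
  raise-greedy-rejects prot (x ∷ ms) c Fc with not (prot x) ∧ not (c x) ∧ not (F (update c x true)) in step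
  ... | true  = raise-greedy-rejects prot ms (update c x true)
                  (not≡true⇒ (proj₂ (∧≡true⇒ {not (c x)} (proj₂ (∧≡true⇒ {not (prot x)} step)))))
  ... | false = raise-greedy-rejects prot ms c Fc

  raise-greedy-maximal : ∀ prot ms c m → m ∈ ms → prot m ≡ false → result F (raise-greedy prot ms c) m ≡ false →
                         F (update (result F (raise-greedy prot ms c)) m true) ≡ true
  raise-greedy-maximal prot (x ∷ ms) c m (there m∈) pm rm with not (prot x) ∧ not (c x) ∧ not (F (update c x true))
  ... | true  = raise-greedy-maximal prot ms (update c x true) m m∈ pm rm
  ... | false = raise-greedy-maximal prot ms c m m∈ pm rm
  raise-greedy-maximal prot (x ∷ ms) c m (here refl) pm rm rewrite pm with c x in cx | F (update c x true) in Fcx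
  ... | true  | _     = ⊥-elim (true≢false (trans (sym (raise-greedy-≥ prot ms c x cx)) rm))
  ... | false | true  = mono (update-mono x true (raise-greedy-≥ prot ms c)) Fcx
  ... | false | false = ⊥-elim (true≢false (trans (sym (raise-greedy-≥ prot ms (update c x true) x (update-same c x true))) rm))

  lower-greedy-≤ : ∀ prot ms d → result F (lower-greedy prot ms d) ≤ₐ d
  lower-greedy-≤ prot []       d m p = p
  lower-greedy-≤ prot (x ∷ ms) d m p with not (prot x) ∧ d x ∧ F (update d x false)
  ... | true  = update-false-≤ₐ d x m (lower-greedy-≤ prot ms (update d x false) m p)
  ... | false = lower-greedy-≤ prot ms d m p

  lower-greedy-protected : ∀ prot ms d m → prot m ≡ true → result F (lower-greedy prot ms d) m ≡ d m
  lower-greedy-protected prot []       d m pm = refl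
  lower-greedy-protected prot (x ∷ ms) d m pm with prot x in px | d x | F (update d x false)
  ... | true  | _     | _     = lower-greedy-protected prot ms d m pm
  ... | false | false | _     = lower-greedy-protected prot ms d m pm
  ... | false | true  | false = lower-greedy-protected prot ms d m pm
  ... | false | true  | true  = trans (lower-greedy-protected prot ms (update d x false) m pm)
                                      (update-other d false λ { refl → true≢false (trans (sym pm) px) })

  lower-greedy-accepts : ∀ prot ms d → F d ≡ true → F (result F (lower-greedy prot ms d)) ≡ true
  lower-greedy-accepts prot []       d Fd = Fd
  lower-greedy-accepts prot (x ∷ ms) d Fd with not (prot x) ∧ d x ∧ F (update d x false) in step
  ... | true  = lower-greedy-accepts prot ms (update d x false) (proj₂ (∧≡true⇒ {d x} (proj₂ (∧≡true⇒ {not (prot x)} step))))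
  ... | false = lower-greedy-accepts prot ms d Fd

  lower-greedy-minimal : ∀ prot ms d m → m ∈ ms → prot m ≡ false → result F (lower-greedy prot ms d) m ≡ true →
                         F (update (result F (lower-greedy prot ms d)) m false) ≡ false
  lower-greedy-minimal prot (x ∷ ms) d m (there m∈) pm rm with not (prot x) ∧ d x ∧ F (update d x false)
  ... | true  = lower-greedy-minimal prot ms (update d x false) m m∈ pm rm
  ... | false = lower-greedy-minimal prot ms d m m∈ pm rm
  lower-greedy-minimal prot (x ∷ ms) d m (here refl) pm rm rewrite pm with d x in dx | F (update d x false) in Fdx
  ... | false | _     = ⊥-elim (true≢false (trans (sym (lower-greedy-≤ prot ms d x rm)) dx))
  ... | true  | false = antimono mono (update-mono x false (lower-greedy-≤ prot ms d)) Fdx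
  ... | true  | true  = ⊥-elim (true≢false (trans (sym (lower-greedy-≤ prot ms (update d x false) x rm)) (update-same d x false)))

-- Discovering the relevant variables

-- For each discovered variable k: a maximal false point and a minimal true point for k.
Explorations : ℕ → Set
Explorations n = Fin n → Maybe (Assignment n × Assignment n)

store : ∀ {n} {X : Set} → (Fin n → Maybe X) → Fin n → X → Fin n → Maybe X
store st k v m = if m == k then just v else st m

length-allFin : ∀ n → length (allFin n) ≡ n
length-allFin n = length-tabulate id

module _ {n : ℕ} where

  -- Meant for a point p on which F is sensitive to k.
  explore : Fin n → Assignment n → MQ n (Assignment n × Assignment n)
  explore k p = raise-greedy (_== k) (allFin n) (update p k false) >>= λ c →
                lower-greedy (_== k) (allFin n) (update p k true) >>= λ d → pure (c , d)

  sensitiveFrom : Fin n → Maybe (Assignment n × Assignment n) → Maybe (Assignment n) → Maybe (Assignment n)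
  sensitiveFrom k nothing        r = r
  sensitiveFrom k (just (c , d)) r = if not (c k) then just c else (if d k then just d else r)

  sensitiveAmong : Explorations n → Fin n → List (Fin n) → Maybe (Assignment n)
  sensitiveAmong st k []       = nothing
  sensitiveAmong st k (j ∷ js) = sensitiveFrom k (st j) (sensitiveAmong st k js)

  -- m₀ is a minimal true point, hence sensitive to each of its 1s.
  sensitivePoint : Assignment n → Explorations n → Fin n → Maybe (Assignment n)
  sensitivePoint m₀ st k = if m₀ k then just m₀ else sensitiveAmong st k (allFin n)

  targetFrom : Fin n → Maybe (Assignment n × Assignment n) → Maybe (Assignment n) →
               Maybe (Fin n × Assignment n) → Maybe (Fin n × Assignment n)
  targetFrom k nothing  (just p) r = just (k , p)
  targetFrom k nothing  nothing  r = r
  targetFrom k (just _) _        r = r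

  nextTarget : Assignment n → Explorations n → List (Fin n) → Maybe (Fin n × Assignment n)
  nextTarget m₀ st []       = nothing
  nextTarget m₀ st (k ∷ ks) = targetFrom k (st k) (sensitivePoint m₀ st k) (nextTarget m₀ st ks)

  exploreTarget : Explorations n → Maybe (Fin n × Assignment n) → MQ n (Explorations n)
  exploreTarget st nothing        = pure st
  exploreTarget st (just (k , p)) = explore k p >>= λ cd → pure (store st k cd)

  round : Assignment n → Explorations n → MQ n (Explorations n)
  round m₀ st = exploreTarget st (nextTarget m₀ st (allFin n))

  rounds : ℕ → Assignment n → Explorations n → MQ n (Explorations n)
  rounds zero    m₀ st = pure st
  rounds (suc r) m₀ st = round m₀ st >>= rounds r m₀

  explore-result : ∀ f k p → result f (explore k p) ≡
    (result f (raise-greedy (_== k) (allFin n) (update p k false)) , result f (lower-greedy (_== k) (allFin n) (update p k true)))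
  explore-result f k p = trans (result->>= f (raise-greedy (_== k) (allFin n) (update p k false)) _)
                               (result->>= f (lower-greedy (_== k) (allFin n) (update p k true)) _)

  explore-cost : ∀ f k p → cost f (explore k p) ≡ n + n
  explore-cost f k p = begin
    cost f (explore k p)
      ≡⟨ cost->>= f (raise-greedy (_== k) (allFin n) (update p k false)) _ ⟩
    cost f (raise-greedy (_== k) (allFin n) _) + cost f (lower-greedy (_== k) (allFin n) (update p k true) >>= _)
      ≡⟨ cong₂ _+_ (raise-greedy-cost f _ (allFin n) _) (cost->>= f (lower-greedy (_== k) (allFin n) _) _) ⟩
    length (allFin n) + (cost f (lower-greedy (_== k) (allFin n) _) + 0)
      ≡⟨ cong (length (allFin n) +_) (trans (+-identityʳ _) (lower-greedy-cost f _ (allFin n) _)) ⟩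
    length (allFin n) + length (allFin n)
      ≡⟨ cong₂ _+_ (length-allFin n) (length-allFin n) ⟩
    n + n ∎
    where open ≡-Reasoning

  round-cost : ∀ f m₀ st → cost f (round m₀ st) ≤ n + n
  round-cost f m₀ st with nextTarget m₀ st (allFin n)
  ... | nothing       = z≤n
  ... | just (k , p)  = ≤-reflexive (trans (cost->>= f (explore k p) _) (trans (+-identityʳ _) (explore-cost f k p)))

  rounds-cost : ∀ f r m₀ st → cost f (rounds r m₀ st) ≤ r * (n + n)
  rounds-cost f zero    m₀ st = z≤n
  rounds-cost f (suc r) m₀ st rewrite cost->>= f (round m₀ st) (rounds r m₀) =
    +-mono-≤ (round-cost f m₀ st) (rounds-cost f r m₀ _)

isJust : ∀ {X : Set} → Maybe X → ℕ
isJust nothing  = 0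
isJust (just _) = 1

countJust : ∀ {n} {X : Set} → (Fin n → Maybe X) → ℕ
countJust {zero}  s = 0
countJust {suc n} s = isJust (s zero) + countJust (λ i → s (suc i))

countJust-cong : ∀ {n} {X : Set} {s t : Fin n → Maybe X} → (∀ i → s i ≡ t i) → countJust s ≡ countJust t
countJust-cong {zero}  s≗t = refl
countJust-cong {suc n} s≗t = cong₂ _+_ (cong isJust (s≗t zero)) (countJust-cong (λ i → s≗t (suc i)))

countJust-nothing : ∀ {n} {X : Set} → countJust {n} {X} (λ _ → nothing) ≡ 0
countJust-nothing {zero}  = refl
countJust-nothing {suc n} = countJust-nothing {n}

countJust-≤ : ∀ {n} {X : Set} (s : Fin n → Maybe X) → countJust s ≤ n
countJust-≤ {zero}  s = z≤n
countJust-≤ {suc n} s with s zero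
... | nothing = m≤n⇒m≤1+n (countJust-≤ (λ i → s (suc i)))
... | just _  = s≤s (countJust-≤ (λ i → s (suc i)))

countJust-< : ∀ {n} {X : Set} (s : Fin n → Maybe X) k → s k ≡ nothing → suc (countJust s) ≤ n
countJust-< {suc n} s zero    sk rewrite sk = s≤s (countJust-≤ (λ i → s (suc i)))
countJust-< {suc n} s (suc k) sk with s zero
... | nothing = m≤n⇒m≤1+n (countJust-< (λ i → s (suc i)) k sk)
... | just _  = s≤s (countJust-< (λ i → s (suc i)) k sk)

countJust-store : ∀ {n} {X : Set} (s : Fin n → Maybe X) k v → s k ≡ nothing → countJust (store s k v) ≡ suc (countJust s)
countJust-store {suc n} s zero    v sk rewrite sk = refl
countJust-store {suc n} s (suc k) v sk =
  trans (cong (isJust (s zero) +_) (trans (countJust-cong (λ i → cong (λ b → if b then just v else s (suc i)) (==-suc i k)))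
                            (countJust-store (λ i → s (suc i)) k v sk)))
        (+-suc (isJust (s zero)) _)

module _ {n : ℕ} (m₀ : Assignment n) where

  nextTarget-just : ∀ st ks {k p} → nextTarget m₀ st ks ≡ just (k , p) → st k ≡ nothing × sensitivePoint m₀ st k ≡ just p
  nextTarget-just st (x ∷ ks) e with st x in sx | sensitivePoint m₀ st x in spx
  ... | nothing | nothing = nextTarget-just st ks e
  ... | just _  | _       = nextTarget-just st ks e
  ... | nothing | just _ with e
  ...   | refl = sx , spx

  nextTarget-nothing : ∀ st ks → nextTarget m₀ st ks ≡ nothing → ∀ {k} → k ∈ ks → st k ≡ nothing →
                       sensitivePoint m₀ st k ≡ nothing
  nextTarget-nothing st (x ∷ ks) e (there k∈) sk with st x | sensitivePoint m₀ st x
  ... | nothing | nothing = nextTarget-nothing st ks e k∈ sk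
  ... | just _  | _       = nextTarget-nothing st ks e k∈ sk
  nextTarget-nothing st (x ∷ ks) e (here refl) sk with sensitivePoint m₀ st x
  ... | nothing = refl
  ... | just _ rewrite sk with e
  ...   | ()

  Finished : Explorations n → Set
  Finished st = nextTarget m₀ st (allFin n) ≡ nothing

  module _ (f : BoolFun n) where

    rounds-finished : ∀ r st → Finished st → result f (rounds r m₀ st) ≡ st
    rounds-finished zero    st fin = refl
    rounds-finished (suc r) st fin rewrite result->>= f (round m₀ st) (rounds r m₀) | fin = rounds-finished r st fin

    rounds-progress : ∀ r st → Finished (result f (rounds r m₀ st)) ⊎ countJust st + r ≤ countJust (result f (rounds r m₀ st))
    rounds-progress zero st = inj₂ (≤-reflexive (+-identityʳ _))
    rounds-progress (suc r) st rewrite result->>= f (round m₀ st) (rounds r m₀) with nextTarget m₀ st (allFin n) in target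
    ... | nothing rewrite rounds-finished r st target = inj₁ target
    ... | just (k , p) rewrite result->>= f (explore k p) (λ cd → pure (store st k cd))
      with rounds-progress r (store st k (result f (explore k p)))
    ...   | inj₁ fin = inj₁ fin
    ...   | inj₂ grow = inj₂ (≤-trans (≤-reflexive count) grow)
      where
      count : countJust st + suc r ≡ countJust (store st k (result f (explore k p))) + r
      count rewrite countJust-store st k (result f (explore k p)) (proj₁ (nextTarget-just st (allFin n) target)) =
        +-suc (countJust st) r

    rounds-finish : Finished (result f (rounds n m₀ (λ _ → nothing)))
    rounds-finish with rounds-progress n (λ _ → nothing)
    ... | inj₁ fin  = fin
    ... | inj₂ grow with nextTarget m₀ (result f (rounds n m₀ (λ _ → nothing))) (allFin n) in target
    ...   | nothing      = refl
    ...   | just (k , p) = ⊥-elim (<-irrefl refl (≤-trans (countJust-< _ k (proj₁ (nextTarget-just _ (allFin n) target)))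
                                                           (≤-trans (≤-reflexive (cong (_+ n) (sym (countJust-nothing {n})))) grow)))

module _ {n : ℕ} where

  sensitiveAmong-some : ∀ st k {j c d} → st j ≡ just (c , d) → c k ≡ false ⊎ d k ≡ true → ∀ js → j ∈ js →
                        Σ (Assignment n) λ p → sensitiveAmong st k js ≡ just p
  sensitiveAmong-some st k sj h (x ∷ js) (there j∈) with st x
  ... | nothing = sensitiveAmong-some st k sj h js j∈
  ... | just (c′ , d′) with c′ k | d′ k
  ...   | false | _     = c′ , refl
  ...   | true  | true  = d′ , refl
  ...   | true  | false = sensitiveAmong-some st k sj h js j∈
  sensitiveAmong-some st k {c = c} {d} sj h (x ∷ js) (here refl) rewrite sj with c k | d k | h
  ... | false | _     | _      = c , refl
  ... | true  | true  | _      = d , refl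
  ... | true  | false | inj₁ ()
  ... | true  | false | inj₂ ()

  sensitivePoint-some : ∀ m₀ st k {j c d} → st j ≡ just (c , d) → c k ≡ false ⊎ d k ≡ true →
                        Σ (Assignment n) λ p → sensitivePoint m₀ st k ≡ just p
  sensitivePoint-some m₀ st k {j} sj h with m₀ k
  ... | true  = m₀ , refl
  ... | false = sensitiveAmong-some st k sj h (allFin n) (∈-allFin j)

  sensitivePoint-on : ∀ m₀ (st : Explorations n) k → m₀ k ≡ true → sensitivePoint m₀ st k ≡ just m₀
  sensitivePoint-on m₀ st k m₀k rewrite m₀k = refl

module Exploration {n : ℕ} (F : BoolFun n) (mono : Monotone F) where

  open Greedy F mono

  everywhere : Fin n → Bool
  everywhere _ = true

  Sensitive : Fin n → Assignment n → Set
  Sensitive k p = F (update p k false) ≡ false × F (update p k true) ≡ true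

  MinimalPoint : Assignment n → Set
  MinimalPoint d = F d ≡ true × (∀ m → d m ≡ true → F (update d m false) ≡ false)

  Consistent : Explorations n → Set
  Consistent st = ∀ {j c d} → st j ≡ just (c , d) → MaximalFalse F everywhere j c × MinimalTrue F everywhere j d

  F-update-id : ∀ (p : Assignment n) {k v} → p k ≡ v → F (update p k v) ≡ F p
  F-update-id p {k} refl = monotone-ext mono (update-id p k)

  explore-correct : ∀ {k p} → Sensitive k p →
                    MaximalFalse F everywhere k (proj₁ (result F (explore k p))) × MinimalTrue F everywhere k (proj₂ (result F (explore k p)))
  explore-correct {k} {p} (p0 , p1) rewrite explore-result F k p =
    maxFalse (trans (raise-greedy-protected _ (allFin n) _ k (==-refl k)) (update-same p k false))
             (raise-greedy-rejects _ (allFin n) _ p0) raiseC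
    , minTrue (trans (lower-greedy-protected _ (allFin n) _ k (==-refl k)) (update-same p k true))
              (lower-greedy-accepts _ (allFin n) _ p1) lowerD
    where
    C = result F (raise-greedy (_== k) (allFin n) (update p k false))
    D = result F (lower-greedy (_== k) (allFin n) (update p k true))
    -- At k itself, maximality (and minimality) come from p being sensitive to k.
    raiseC : ∀ m → everywhere m ≡ true → C m ≡ false → F (update C m true) ≡ true
    raiseC m _ Cm with m ≟ k
    ... | yes refl = mono (λ m′ q → update-mono m true (raise-greedy-≥ _ (allFin n) (update p m false)) m′
                                      (trans (update-update p m false true m′) q)) p1
    ... | no m≢k  = raise-greedy-maximal _ (allFin n) _ m (∈-allFin m) (==-≢ m≢k) Cm
    lowerD : ∀ m → everywhere m ≡ true → D m ≡ true → F (update D m false) ≡ false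
    lowerD m _ Dm with m ≟ k
    ... | yes refl = antimono mono (λ m′ q → trans (sym (update-update p m true false m′))
                                               (update-mono m false (lower-greedy-≤ _ (allFin n) (update p m true)) m′ q)) p0
    ... | no m≢k  = lower-greedy-minimal _ (allFin n) _ m (∈-allFin m) (==-≢ m≢k) Dm

  sensitiveAmong-sound : ∀ {st} → Consistent st → ∀ k js {p} → sensitiveAmong st k js ≡ just p → Sensitive k p
  sensitiveAmong-sound {st} cons k (j ∷ js) e with st j in sj
  ... | nothing = sensitiveAmong-sound cons k js e
  ... | just (c , d) with c k in ck | d k in dk
  ...   | false | _ with e
  ...     | refl = trans (F-update-id c ck) (rejects (proj₁ (cons sj))) , raise (proj₁ (cons sj)) k refl ck
  sensitiveAmong-sound {st} cons k (j ∷ js) e | just (c , d) | true | true with e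
  ...     | refl = lower (proj₂ (cons sj)) k refl dk , trans (F-update-id d dk) (accepts (proj₂ (cons sj)))
  sensitiveAmong-sound {st} cons k (j ∷ js) e | just (c , d) | true | false = sensitiveAmong-sound cons k js e

  sensitivePoint-sound : ∀ {m₀ st} → MinimalPoint m₀ → Consistent st → ∀ k {p} → sensitivePoint m₀ st k ≡ just p → Sensitive k p
  sensitivePoint-sound {m₀} (m₀-true , m₀-min) cons k e with m₀ k in m₀k
  ... | false = sensitiveAmong-sound cons k (allFin n) e
  ... | true with e
  ...   | refl = m₀-min k m₀k , trans (F-update-id m₀ m₀k) m₀-true

  round-consistent : ∀ {m₀ st} → MinimalPoint m₀ → Consistent st → Consistent (result F (round m₀ st))
  round-consistent {m₀} {st} min cons with nextTarget m₀ st (allFin n) in target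
  ... | nothing = cons
  ... | just (k , p) rewrite result->>= F (explore k p) (λ cd → pure (store st k cd)) = cons′
    where
    ok = explore-correct (sensitivePoint-sound min cons k (proj₂ (nextTarget-just m₀ st (allFin n) target)))
    cons′ : Consistent (store st k (result F (explore k p)))
    cons′ {j} e with j ≟ k
    ... | no _     = cons e
    ... | yes refl with e
    ...   | refl = ok

  rounds-consistent : ∀ r {m₀ st} → MinimalPoint m₀ → Consistent st → Consistent (result F (rounds r m₀ st))
  rounds-consistent zero    min cons = cons
  rounds-consistent (suc r) {m₀} {st} min cons rewrite result->>= F (round m₀ st) (rounds r m₀) =
    rounds-consistent r min (round-consistent min cons)

module _ {n : ℕ} {a : Assignment n} where

  Certificate-transfer : ∀ {occ occ′ link link′ S S′} → (∀ s → occ s ≡ occ′ s) →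
    (∀ s t → occ s ≡ true → occ t ≡ true → s ≢ t → link s t ≡ link′ s t) → (∀ s → S s ≡ S′ s) →
    Certificate occ link a S → Certificate occ′ link′ a S′
  Certificate-transfer {occ} {occ′} {link} {link′} {S} {S′} occ≗ link≗ S≗ C =
    certificate chosen′ (s₀ , trans (sym (S≗ s₀)) Ss₀) linked′ blocked′
    where
    s₀ = proj₁ (nonempty C)
    Ss₀ = proj₂ (nonempty C)
    chosen′ : ∀ s → S′ s ≡ true → occ′ s ≡ true × a s ≡ true
    chosen′ s p = let (os , as) = chosen C s (trans (S≗ s) p) in trans (sym (occ≗ s)) os , as
    linked′ : ∀ s t → S′ s ≡ true → S′ t ≡ true → s ≢ t → link′ s t ≡ true
    linked′ s t p q s≢t = let Ss = trans (S≗ s) p ; St = trans (S≗ t) q in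
      trans (sym (link≗ s t (proj₁ (chosen C s Ss)) (proj₁ (chosen C t St)) s≢t)) (linked C s t Ss St s≢t)
    blocked′ : ∀ v → occ′ v ≡ true → a v ≡ false → Σ (Fin n) λ s → S′ s ≡ true × link′ v s ≡ false
    blocked′ v o′v av with blocked C v (trans (occ≗ v) o′v) av
    ... | s , Ss , ¬l = s , trans (sym (S≗ s)) Ss ,
                        trans (sym (link≗ v s (trans (occ≗ v) o′v) (proj₁ (chosen C s Ss)) v≢s)) ¬l
      where
      v≢s : v ≢ s
      v≢s refl = true≢false (trans (sym (proj₂ (chosen C s Ss))) av)

  certificate? : ∀ occ link S → Dec (Certificate occ link a S)
  certificate? occ link S = map′ (λ (c₁ , c₂ , c₃ , c₄) → certificate c₁ c₂ c₃ c₄)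
                                 (λ C → chosen C , nonempty C , linked C , blocked C)
    (all? (λ s → (S s ≟ᵇ true) →-dec ((occ s ≟ᵇ true) ×-dec (a s ≟ᵇ true))) ×-dec
     any? (λ s → S s ≟ᵇ true) ×-dec
     all? (λ s → all? λ t → (S s ≟ᵇ true) →-dec (S t ≟ᵇ true) →-dec ¬? (s ≟ t) →-dec (link s t ≟ᵇ true)) ×-dec
     all? (λ v → (occ v ≟ᵇ true) →-dec (a v ≟ᵇ false) →-dec any? (λ s → (S s ≟ᵇ true) ×-dec (link v s ≟ᵇ false))))

hypothesis : ∀ {n} → (Fin n → Bool) → (Fin n → Fin n → Bool) → BoolFun n
hypothesis occ link a = does (anySubset? λ S → certificate? {a = a} occ link (lookup S))

hypothesis-correct : ∀ {n} (φ : Formula n) → ReadOnceTree φ → ∀ {occ link} → (∀ m → occ m ≡ occurs φ m) →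
  (∀ s t → occurs φ s ≡ true → occurs φ t ≡ true → s ≢ t → link s t ≡ ∧-linked φ s t) →
  ∀ a → hypothesis occ link a ≡ eval φ a
hypothesis-correct φ ro {occ} {link} occ≗ link≗ a with anySubset? (λ S → certificate? {a = a} occ link (lookup S))
... | yes (S , C) = sym (true-of-certificate φ ro (Certificate-transfer occ≗ (λ s t os ot → link≗ s t (trans (sym (occ≗ s)) os) (trans (sym (occ≗ t)) ot)) (λ _ → refl) C))
... | no ¬C with eval φ a in φa
...   | false = refl
...   | true with certificate-of-true φ ro φa
...     | S , C = ⊥-elim (¬C (tabulate S , Certificate-transfer (sym ∘ occ≗) (λ s t os ot s≢t → sym (link≗ s t os ot s≢t))
                                                              (λ s → sym (lookup∘tabulate S s)) C))

tabulateMQ : ∀ {n} {A : Set} m → (Fin m → MQ n A) → MQ n (Fin m → A)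
tabulateMQ zero    g = pure λ ()
tabulateMQ (suc m) g = g zero >>= λ x → tabulateMQ m (g ∘ suc) >>= λ t → pure (x Vector.∷ t)

tabulateMQ-result : ∀ {n} {A : Set} f m (g : Fin m → MQ n A) i → result f (tabulateMQ m g) i ≡ result f (g i)
tabulateMQ-result f (suc m) g i
  rewrite result->>= f (g zero) (λ x → tabulateMQ m (g ∘ suc) >>= λ t → pure (x Vector.∷ t))
        | result->>= f (tabulateMQ m (g ∘ suc)) (λ t → pure (result f (g zero) Vector.∷ t)) with i
... | zero  = refl
... | suc i = tabulateMQ-result f m (g ∘ suc) i

tabulateMQ-cost : ∀ {n} {A : Set} f m (g : Fin m → MQ n A) c → (∀ i → cost f (g i) ≡ c) → cost f (tabulateMQ m g) ≡ m * c
tabulateMQ-cost f zero    g c costs = refl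
tabulateMQ-cost f (suc m) g c costs
  rewrite cost->>= f (g zero) (λ x → tabulateMQ m (g ∘ suc) >>= λ t → pure (x Vector.∷ t))
        | cost->>= f (tabulateMQ m (g ∘ suc)) (λ t → pure (result f (g zero) Vector.∷ t))
        | costs zero | tabulateMQ-cost f m (g ∘ suc) c (costs ∘ suc) = cong (c +_) (+-identityʳ (m * c))

module _ {n : ℕ} where

  isExplored : Maybe (Assignment n × Assignment n) → Bool
  isExplored nothing  = false
  isExplored (just _) = true

  lowPoint : Maybe (Assignment n × Assignment n) → Assignment n
  lowPoint nothing        = λ _ → false
  lowPoint (just (c , _)) = c

  pairQuery : Explorations n → Fin n → Fin n → Assignment n
  pairQuery st i j = pairPoint (lowPoint (st i)) (lowPoint (st j)) i j

  pairTable : Explorations n → MQ n (Fin n → Fin n → Bool)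
  pairTable st = tabulateMQ n λ i → tabulateMQ n λ j → query (pairQuery st i j) pure

  linkTable : Explorations n → (Fin n → Fin n → Bool) → Fin n → Fin n → Bool
  linkTable st answers i j = lowPoint (st j) i ∧ lowPoint (st i) j ∧ answers i j

  minimalPoint : MQ n (Assignment n)
  minimalPoint = lower-greedy (λ _ → false) (allFin n) (λ _ → true)

  learnFrom : Explorations n → MQ n (BoolFun n)
  learnFrom st = pairTable st >>= λ answers → pure (hypothesis (isExplored ∘ st) (linkTable st answers))

  learner : MQ n (BoolFun n)
  learner = minimalPoint >>= λ m₀ → rounds n m₀ (λ _ → nothing) >>= learnFrom

  learnFrom-cost : ∀ f st → cost f (learnFrom st) ≡ n * (n * 1)
  learnFrom-cost f st = trans (cost->>= f (pairTable st) _)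
    (trans (+-identityʳ _) (tabulateMQ-cost f n _ (n * 1) λ i → tabulateMQ-cost f n _ 1 λ j → refl))

  learner-cost : ∀ f → cost f learner ≤ 4 * (n * n)
  learner-cost f = begin
    cost f learner
      ≡⟨ cost->>= f minimalPoint _ ⟩
    cost f minimalPoint + cost f (rounds n m₀ ∅ >>= learnFrom)
      ≡⟨ cong₂ _+_ (trans (lower-greedy-cost f _ (allFin n) _) (length-allFin n)) (cost->>= f (rounds n m₀ ∅) learnFrom) ⟩
    n + (cost f (rounds n m₀ ∅) + cost f (learnFrom (result f (rounds n m₀ ∅))))
      ≤⟨ +-monoʳ-≤ n (+-mono-≤ (rounds-cost f n m₀ ∅) (≤-reflexive (learnFrom-cost f _))) ⟩
    n + (n * (n + n) + n * (n * 1))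
      ≤⟨ +-monoˡ-≤ _ (n≤n*n n) ⟩
    n * n + (n * (n + n) + n * (n * 1))
      ≡⟨ four-squares n ⟩
    4 * (n * n) ∎
    where
    open ≤-Reasoning
    m₀ = result f minimalPoint
    ∅ : Explorations n
    ∅ = λ _ → nothing
    n≤n*n : ∀ n → n ≤ n * n
    n≤n*n zero    = z≤n
    n≤n*n (suc k) = m≤m*n (suc k) (suc k)
    four-squares : ∀ n → n * n + (n * (n + n) + n * (n * 1)) ≡ 4 * (n * n)
    four-squares = solve-∀

module LearnerCorrect {n : ℕ} (φ : Formula n) (ro : ReadOnceTree φ) where

  private
    F = eval φ
    ∅ : Explorations n
    ∅ = λ _ → nothing

  open Greedy F (eval-mono φ)
  open Exploration F (eval-mono φ)

  m₀ : Assignment n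
  m₀ = result F minimalPoint

  m₀-minimal : MinimalPoint m₀
  m₀-minimal = lower-greedy-accepts _ (allFin n) _ (eval-all-true φ λ _ _ → refl) ,
               λ m m₀m → lower-greedy-minimal _ (allFin n) _ m (∈-allFin m) refl m₀m

  final : Explorations n
  final = result F (rounds n m₀ ∅)

  final-consistent : Consistent final
  final-consistent = rounds-consistent n m₀-minimal λ ()

  explored-of-sensitive : ∀ m {p} → sensitivePoint m₀ final m ≡ just p → isExplored (final m) ≡ true
  explored-of-sensitive m e with final m in fm
  ... | just _  = refl
  ... | nothing with trans (sym (nextTarget-nothing m₀ final (allFin n) (rounds-finish m₀ F) (∈-allFin m) fm)) e
  ...   | ()

  explored⇒occurs : ∀ m → isExplored (final m) ≡ true → occurs φ m ≡ true
  explored⇒occurs m e with final m in fm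
  ... | just (c , d) with proj₁ (final-consistent fm) | true-or-false (occurs φ m)
  ...   | _                     | inj₁ φm  = φm
  ...   | maxFalse cm Fc raiseC | inj₂ ¬φm =
    ⊥-elim (true≢false (trans (sym (raiseC m refl cm)) (trans (eval-update-absent φ true ¬φm) Fc)))

  final-closed : Closed φ (isExplored ∘ final)
  final-closed k _ _ with final k in fk
  ... | just (c , d) with final-consistent fk
  ...   | maxFalse ck Fc raiseC , minTrue dk Fd lowerD =
    explored c d (maxFalse ck Fc λ m _ → raiseC m refl) (minTrue dk Fd λ m _ → lowerD m refl)
      (λ m _ cm → explored-of-sensitive m (proj₂ (sensitivePoint-some m₀ final m fk (inj₁ cm))))
      (λ m _ dm → explored-of-sensitive m (proj₂ (sensitivePoint-some m₀ final m fk (inj₂ dm))))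

  final-meets : Meets φ (isExplored ∘ final)
  final-meets with true-witness φ (proj₁ m₀-minimal)
  ... | k , φk , m₀k = k , φk , explored-of-sensitive k (sensitivePoint-on m₀ final k m₀k)

  explored≡occurs : ∀ m → isExplored (final m) ≡ occurs φ m
  explored≡occurs m with true-or-false (occurs φ m)
  ... | inj₁ φm = trans (Closed-complete φ ro final-closed final-meets m φm) (sym φm)
  ... | inj₂ ¬φm = trans (≢true⇒≡false λ e → true≢false (trans (sym (explored⇒occurs m e)) ¬φm)) (sym ¬φm)

  answers : Fin n → Fin n → Bool
  answers = result F (pairTable final)

  answers≡ : ∀ i j → answers i j ≡ F (pairQuery final i j)
  answers≡ i j = trans (cong (λ row → row j) (tabulateMQ-result F n (λ i → tabulateMQ n λ j → query (pairQuery final i j) pure) i))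
                      (tabulateMQ-result F n (λ j → query (pairQuery final i j) pure) j)

  lowPoint-max : ∀ {k} → occurs φ k ≡ true → MaxFalse φ k (lowPoint (final k))
  lowPoint-max {k} φk with final k in fk | explored≡occurs k
  ... | just (c , d) | _ with proj₁ (final-consistent fk)
  ...   | maxFalse ck Fc raiseC = maxFalse ck Fc λ m _ → raiseC m refl
  lowPoint-max {k} φk | nothing | nothing≡occurs = ⊥-elim (true≢false (trans (sym φk) (sym nothing≡occurs)))

  linkTable-correct : ∀ s t → occurs φ s ≡ true → occurs φ t ≡ true → s ≢ t → linkTable final answers s t ≡ ∧-linked φ s t
  linkTable-correct s t φs φt s≢t rewrite answers≡ s t =
    sym (∧-linked-pairPoint φ ro φs φt s≢t (lowPoint-max φs) (lowPoint-max φt))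

  learner-result : result F learner ≡ hypothesis (isExplored ∘ final) (linkTable final answers)
  learner-result = trans (result->>= F minimalPoint _)
                  (trans (result->>= F (rounds n m₀ ∅) learnFrom) (result->>= F (pairTable final) _))

  learner-correct : ∀ a → result F learner a ≡ eval φ a
  learner-correct a = trans (cong (λ h → h a) learner-result)
                            (hypothesis-correct φ ro explored≡occurs linkTable-correct a)

theorem1 : Σ ℕ λ c → Σ ((n : ℕ) → Algorithm n) λ A →
    ∀ (n : ℕ) (f : BoolFun n) → ReadOnce f → NonConstant f →
      ∃ λ q → ∃ λ h → Runs (A n) f q h × q ≤ c * (n * n) × (∀ a → h a ≡ f a)
theorem1 = 4 , (λ n → toAlgorithm learner) , λ n f (φ , u , φ≗f) _ →
  let subcube-answers = below-answer (Monotone-cong φ≗f (eval-mono φ))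
                             (trans (sym (φ≗f _)) (eval-all-false φ λ _ _ → refl))
  in cost f learner , result f learner , toAlgorithm-runs f subcube-answers learner , learner-cost f ,
     λ a → trans (cong (λ h → h a) (result-cong (sym ∘ φ≗f) learner))
                 (trans (LearnerCorrect.learner-correct φ (readOnceTree φ u) a) (φ≗f a))
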